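{- Suppose that $M(A)$, $N(B)$, $P(C)$ are matroids and that the pairs $(M,N)$, $(M\mathbin{\Join} N,P)$, $(N,P)$, and $(M,N\mathbin{\Join} P)$ are matched. Then $(M\mathbin{\Join} N)\mathbin{\Join} P=M\mathbin{\Join}(N\mathbin{\Join} P)$ if and only if either $(A\cap C)-B=\emptyset$ or one of the following holds: (a) $(A\cap C)-B\subseteq\mathrm{isthm}(M)$ and $B-A\subseteq\mathrm{isthm}(N)$; (b) $(A\cap C)-B\subseteq\mathrm{loops}(P)$ and $B-C\subseteq\mathrm{loops}(N)$; (c) (i) $B\subseteq A\cup C$, (ii) $B-A\subseteq\mathrm{isthm}(N)$ and $B-C\subseteq\mathrm{loops}(N)$, and (iii) $((A\cap C)-B,\,A\cap B\cap C)$ is a modular pair in $P$.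
   Context: $K|X$ is restriction; $K.X$ is contraction of $K$ to $X$, i.e. $K/(E-X)$. Matroids $M(A)$, $N(B)$ are matched if $M.(A\cap B)=N|(A\cap B)$. Free splice $M\mathbin{\Join} N$ of matched $M(A)$, $N(B)$: matroid on $A\cup B$ with rank $r(X)=\min\{r_M(X\cap A)+|X-A|,\ r_N(X\cap B)+r_M(A-B)\}$. $\mathrm{loops}(K)$, $\mathrm{isthm}(K)$ are the sets of loops and isthmuses. $(X,Y)$ is a modular pair in $P$ if $r_P(X)+r_P(Y)=r_P(X\cup Y)+r_P(X\cap Y)$. -}

module Defs where

open import Data.Nat using (ℕ; _+_; _∸_; _≤_; _<_; _⊓_)
open import Data.Fin using (Fin)
open import Data.Fin.Subset using (Subset; _∪_; _∩_; _─_; _-_; _⊆_; _∈_; ∣_∣; ⁅_⁆)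
open import Data.Product using (_×_)
open import Relation.Binary.PropositionalEquality using (_≡_)

-- All ground sets live inside a common finite universe Fin n.
-- A "ranked set" is a ground set E together with a rank function;
-- only its values on subsets of E are meaningful.
record RankedSet (n : ℕ) : Set where
  constructor mkRS
  field
    ground : Subset n
    rank   : Subset n → ℕ
open RankedSet public

record IsMatroid {n : ℕ} (K : RankedSet n) : Set where
  field
    rank-≤-card : ∀ X → X ⊆ ground K → rank K X ≤ ∣ X ∣
    rank-mono   : ∀ X Y → X ⊆ Y → Y ⊆ ground K → rank K X ≤ rank K Y
    rank-submod : ∀ X Y → X ⊆ ground K → Y ⊆ ground K →
                  rank K (X ∪ Y) + rank K (X ∩ Y) ≤ rank K X + rank K Y


_≅_ : ∀ {n} → RankedSet n → RankedSet n → Set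
K ≅ L = (ground K ≡ ground L) × (∀ X → X ⊆ ground K → rank K X ≡ rank L X)

_∣ʳ_ : ∀ {n} → RankedSet n → Subset n → RankedSet n
K ∣ʳ X = mkRS X (rank K)

-- Contraction K.X = K/(E - X): ground X, r(Y) = r_K(Y ∪ (E - X)) - r_K(E - X).
_·_ : ∀ {n} → RankedSet n → Subset n → RankedSet n
K · X = mkRS X (λ Y → rank K (Y ∪ (ground K ─ X)) ∸ rank K (ground K ─ X))

Matched : ∀ {n} → RankedSet n → RankedSet n → Set
Matched M N = (M · (ground M ∩ ground N)) ≅ (N ∣ʳ (ground M ∩ ground N))

_⋈_ : ∀ {n} → RankedSet n → RankedSet n → RankedSet n
M ⋈ N = mkRS (A ∪ B)
  (λ X → (rank M (X ∩ A) + ∣ X ─ A ∣) ⊓ (rank N (X ∩ B) + rank M (A ─ B)))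
  where
  A = ground M
  B = ground N

loops : ∀ {n} → RankedSet n → Fin n → Set
loops K e = (e ∈ ground K) × (rank K ⁅ e ⁆ ≡ 0)

isthm : ∀ {n} → RankedSet n → Fin n → Set
isthm K e = (e ∈ ground K) × (rank K (ground K - e) < rank K (ground K))

_⊆ₚ_ : ∀ {n} → Subset n → (Fin n → Set) → Set
X ⊆ₚ S = ∀ {e} → e ∈ X → S e

ModularPair : ∀ {n} → RankedSet n → Subset n → Subset n → Set
ModularPair P X Y = rank P X + rank P Y ≡ rank P (X ∪ Y) + rank P (X ∩ Y)

-- Write rA∖B = r_M(A - B), rA∖BC = r_M(A - (B ∪ C)), rB∖C = r_N(B - C) and
-- S = (A ∩ C) - B. Unfolding the free splices, the rank of X in (M ⋈ N) ⋈ P and in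
-- M ⋈ (N ⋈ P) is a minimum of four, resp. three, terms sharing the first one, and
-- the four matchings relate the ranks occurring in them; matching M with N ⋈ P
-- gives rA∖B = rA∖BC + min(|S|, r_P(S) + rB∖C).
-- If rA∖B = rA∖BC (S empty, or S and B - C consisting of loops) the two minima
-- agree. If rA∖BC < rA∖B, comparing the ranks of the whole ground set shows that
-- the splices can only agree when r_{M⋈N}((A ∪ B) - C) takes its least possible
-- value rA∖BC + rB∖C, and in that regime they always agree. There B - A consists
-- of isthmuses of N, and either S consists of isthmuses of M (when
-- rA∖B = rA∖BC + |S|), or rB∖C = 0 and computing r_P(S), r_P(A ∩ B ∩ C) and
-- r_P(S ∪ (A ∩ B ∩ C)) through the matchings yields the modularity of (c).

module Submission where

open import Defs
open import Data.Bool using (Bool; true; false; _∧_; _∨_; not)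
import Data.Bool.Properties as Bool
open import Data.Empty using (⊥-elim)
open import Data.Fin using (Fin; zero; suc)
open import Data.Fin.Subset
  using (Subset; _∪_; _∩_; _─_; _-_; _⊆_; _∈_; ∣_∣; ⁅_⁆; ⊥; Empty; Nonempty)
open import Data.Fin.Subset.Properties
  using ( ⊆-antisym; ∣⊥∣≡0; p⊆q⇒∣p∣≤∣q∣; p∩q⊆q; x∈p∩q⁻; x∈p∩q⁺; x∈p∪q⁻; x∈p∪q⁺; p─⊥≡p; ⊆-min
        ; x∈⁅y⁆⇒x≡y; Empty-unique; nonempty?; _∈?_; x∈p∧x∉q⇒x∈p─q)
open import Data.Nat using (ℕ; zero; suc; _+_; _∸_; _≤_; _<_; _⊓_; z≤n; s≤s; _≤?_)
open import Data.Nat.Properties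
open import Data.Nat.Tactic.RingSolver using (solve-∀)
open import Algebra.Properties.CommutativeSemigroup +-commutativeSemigroup
  using (xy∙z≈xz∙y; xy∙z≈x∙zy; x∙yz≈y∙xz; x∙yz≈yx∙z)
open import Data.Product using (_×_; _,_; proj₁; proj₂; uncurry)
open import Data.Sum using (_⊎_; inj₁; inj₂)
open import Data.Vec using (Vec; []; _∷_; lookup; map; head; tail; here; there)
open import Data.Vec.Properties using (lookup-map)
open import Function.Bundles using (_⇔_; mk⇔)
open import Relation.Binary.PropositionalEquality
open import Relation.Nullary using (¬_; Dec; yes; no)
open import Relation.Nullary.Decidable using (True; toWitness; map′; _×-dec_)

-- Boolean identities between subsets, decided by truth tables

data SetExpr (k : ℕ) : Set where
  var             : Fin k → SetExpr k
  ∅ᵉ              : SetExpr k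
  _∪ᵉ_ _∩ᵉ_ _─ᵉ_ : SetExpr k → SetExpr k → SetExpr k

infixr 7 _∩ᵉ_
infixr 6 _∪ᵉ_
infixl 5 _─ᵉ_

⟦_⟧ : ∀ {k n} → SetExpr k → Vec (Subset n) k → Subset n
⟦ var i ⟧   ρ = lookup ρ i
⟦ ∅ᵉ ⟧      ρ = ⊥
⟦ e ∪ᵉ f ⟧ ρ = ⟦ e ⟧ ρ ∪ ⟦ f ⟧ ρ
⟦ e ∩ᵉ f ⟧ ρ = ⟦ e ⟧ ρ ∩ ⟦ f ⟧ ρ
⟦ e ─ᵉ f ⟧ ρ = ⟦ e ⟧ ρ ─ ⟦ f ⟧ ρ

truth : ∀ {k} → SetExpr k → Vec Bool k → Bool
truth (var i)   β = lookup β i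
truth ∅ᵉ        β = false
truth (e ∪ᵉ f) β = truth e β ∨ truth f β
truth (e ∩ᵉ f) β = truth e β ∧ truth f β
truth (e ─ᵉ f) β = truth e β ∧ not (truth f β)

∀-assignment? : ∀ {k} {P : Vec Bool k → Set} → (∀ β → Dec (P β)) → Dec (∀ β → P β)
∀-assignment? {zero}  P? = map′ (λ p → λ { [] → p }) (λ h → h []) (P? [])
∀-assignment? {suc k} P? =
  map′ (λ (t , f) → λ { (true ∷ β) → t β ; (false ∷ β) → f β })
       (λ h → (λ β → h (true ∷ β)) , (λ β → h (false ∷ β)))
       (∀-assignment? (λ β → P? (true ∷ β)) ×-dec ∀-assignment? (λ β → P? (false ∷ β)))

private
  ─-∷ : ∀ {n} x y (p q : Subset n) → (x ∷ p) ─ (y ∷ q) ≡ (x ∧ not y) ∷ (p ─ q)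
  ─-∷ true  true  p q = refl
  ─-∷ true  false p q = refl
  ─-∷ false true  p q = refl
  ─-∷ false false p q = refl

  ∷-η : ∀ {n} (p : Subset (suc n)) → p ≡ head p ∷ tail p
  ∷-η (x ∷ p) = refl

  ⟦⟧-∷ : ∀ {k n} (e : SetExpr k) (ρ : Vec (Subset (suc n)) k) →
         ⟦ e ⟧ ρ ≡ truth e (map head ρ) ∷ ⟦ e ⟧ (map tail ρ)
  ⟦⟧-∷ (var i) ρ rewrite lookup-map i head ρ | lookup-map i tail ρ = ∷-η (lookup ρ i)
  ⟦⟧-∷ ∅ᵉ ρ = refl
  ⟦⟧-∷ (e ∪ᵉ f) ρ rewrite ⟦⟧-∷ e ρ | ⟦⟧-∷ f ρ = refl
  ⟦⟧-∷ (e ∩ᵉ f) ρ rewrite ⟦⟧-∷ e ρ | ⟦⟧-∷ f ρ = refl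
  ⟦⟧-∷ (e ─ᵉ f) ρ rewrite ⟦⟧-∷ e ρ | ⟦⟧-∷ f ρ =
    ─-∷ (truth e (map head ρ)) (truth f (map head ρ)) (⟦ e ⟧ (map tail ρ)) (⟦ f ⟧ (map tail ρ))

  same-truth⇒≡ : ∀ {k} (e f : SetExpr k) → (∀ β → truth e β ≡ truth f β) →
                 ∀ {n} (ρ : Vec (Subset n) k) → ⟦ e ⟧ ρ ≡ ⟦ f ⟧ ρ
  same-truth⇒≡ e f t {zero}  ρ with ⟦ e ⟧ ρ | ⟦ f ⟧ ρ
  ... | [] | [] = refl
  same-truth⇒≡ e f t {suc n} ρ rewrite ⟦⟧-∷ e ρ | ⟦⟧-∷ f ρ =
    cong₂ _∷_ (t (map head ρ)) (same-truth⇒≡ e f t (map tail ρ))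

set-≡ : ∀ {k} (e f : SetExpr k) {_ : True (∀-assignment? λ β → truth e β Bool.≟ truth f β)}
        {n} (ρ : Vec (Subset n) k) → ⟦ e ⟧ ρ ≡ ⟦ f ⟧ ρ
set-≡ e f {valid} = same-truth⇒≡ e f (toWitness valid)

set-⊆ : ∀ {k} (e f : SetExpr k) {_ : True (∀-assignment? λ β → truth (e ∩ᵉ f) β Bool.≟ truth e β)}
        {n} (ρ : Vec (Subset n) k) → ⟦ e ⟧ ρ ⊆ ⟦ f ⟧ ρ
set-⊆ e f {valid} ρ x∈e = p∩q⊆q (⟦ e ⟧ ρ) (⟦ f ⟧ ρ) (subst (_ ∈_) (sym (set-≡ (e ∩ᵉ f) e {valid} ρ)) x∈e)

pattern 𝟎 = var zero
pattern 𝟏 = var (suc zero)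
pattern 𝟐 = var (suc (suc zero))
pattern 𝟑 = var (suc (suc (suc zero)))

-- Cardinalities and inclusions of subsets

∣p∣≡∣p∩q∣+∣p─q∣ : ∀ {n} (p q : Subset n) → ∣ p ∣ ≡ ∣ p ∩ q ∣ + ∣ p ─ q ∣
∣p∣≡∣p∩q∣+∣p─q∣ []          []          = refl
∣p∣≡∣p∩q∣+∣p─q∣ (true ∷ p)  (true ∷ q)  = cong suc (∣p∣≡∣p∩q∣+∣p─q∣ p q)
∣p∣≡∣p∩q∣+∣p─q∣ (true ∷ p)  (false ∷ q) = trans (cong suc (∣p∣≡∣p∩q∣+∣p─q∣ p q)) (sym (+-suc _ _))
∣p∣≡∣p∩q∣+∣p─q∣ (false ∷ p) (true ∷ q)  = ∣p∣≡∣p∩q∣+∣p─q∣ p q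
∣p∣≡∣p∩q∣+∣p─q∣ (false ∷ p) (false ∷ q) = ∣p∣≡∣p∩q∣+∣p─q∣ p q

x∈p⇒∣p∣≡1+∣p-x∣ : ∀ {n} {x : Fin n} {p : Subset n} → x ∈ p → ∣ p ∣ ≡ suc ∣ p - x ∣
x∈p⇒∣p∣≡1+∣p-x∣ {p = true ∷ p}  here       = cong (λ q → suc ∣ q ∣) (sym (p─⊥≡p p))
x∈p⇒∣p∣≡1+∣p-x∣ {p = true ∷ p}  (there x∈) = cong suc (x∈p⇒∣p∣≡1+∣p-x∣ x∈)
x∈p⇒∣p∣≡1+∣p-x∣ {p = false ∷ p} (there x∈) = x∈p⇒∣p∣≡1+∣p-x∣ x∈

x∈p⇒0<∣p∣ : ∀ {n} {x : Fin n} {p : Subset n} → x ∈ p → 0 < ∣ p ∣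
x∈p⇒0<∣p∣ x∈ rewrite x∈p⇒∣p∣≡1+∣p-x∣ x∈ = s≤s z≤n

∣p∣≡1+k⇒Nonempty : ∀ {n} (p : Subset n) {k} → ∣ p ∣ ≡ suc k → Nonempty p
∣p∣≡1+k⇒Nonempty (true ∷ p)  _  = zero , here
∣p∣≡1+k⇒Nonempty (false ∷ p) eq with ∣p∣≡1+k⇒Nonempty p eq
... | x , x∈ = suc x , there x∈

∣p∣≡0⇒p≡⊥ : ∀ {n} {p : Subset n} → ∣ p ∣ ≡ 0 → p ≡ ⊥
∣p∣≡0⇒p≡⊥ {p = []}        _  = refl
∣p∣≡0⇒p≡⊥ {p = false ∷ p} eq = cong (false ∷_) (∣p∣≡0⇒p≡⊥ eq)

x∈p⇒⁅x⁆⊆p : ∀ {n} {x : Fin n} {p : Subset n} → x ∈ p → ⁅ x ⁆ ⊆ p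
x∈p⇒⁅x⁆⊆p {x = x} {p} x∈ y∈ = subst (_∈ p) (sym (x∈⁅y⁆⇒x≡y x y∈)) x∈

∪-least : ∀ {n} {p q r : Subset n} → p ⊆ r → q ⊆ r → p ∪ q ⊆ r
∪-least {p = p} {q} p⊆r q⊆r x∈ with x∈p∪q⁻ p q x∈
... | inj₁ x∈p = p⊆r x∈p
... | inj₂ x∈q = q⊆r x∈q

q⊆p⇒p∪q≡p : ∀ {n} {p q : Subset n} → q ⊆ p → p ∪ q ≡ p
q⊆p⇒p∪q≡p {p = p} q⊆p = ⊆-antisym (∪-least (λ x∈ → x∈) q⊆p) (λ x∈ → x∈p∪q⁺ (inj₁ x∈))

p⊆q⇒p∩q≡p : ∀ {n} {p q : Subset n} → p ⊆ q → p ∩ q ≡ p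
p⊆q⇒p∩q≡p {p = p} {q} p⊆q = ⊆-antisym (λ x∈ → proj₁ (x∈p∩q⁻ p q x∈)) (λ x∈ → x∈p∩q⁺ (x∈ , p⊆q x∈))

∩-monoˡ-⊆ : ∀ {n} {p q : Subset n} r → p ⊆ q → p ∩ r ⊆ q ∩ r
∩-monoˡ-⊆ {p = p} {q} r p⊆q =
  subst (λ s → s ∩ r ⊆ q ∩ r) (p⊆q⇒p∩q≡p p⊆q) (set-⊆ ((𝟎 ∩ᵉ 𝟏) ∩ᵉ 𝟐) (𝟏 ∩ᵉ 𝟐) (p ∷ q ∷ r ∷ []))

─-monoˡ-⊆ : ∀ {n} {p q : Subset n} r → p ⊆ q → p ─ r ⊆ q ─ r
─-monoˡ-⊆ {p = p} {q} r p⊆q =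
  subst (λ s → s ─ r ⊆ q ─ r) (p⊆q⇒p∩q≡p p⊆q) (set-⊆ ((𝟎 ∩ᵉ 𝟏) ─ᵉ 𝟐) (𝟏 ─ᵉ 𝟐) (p ∷ q ∷ r ∷ []))

-- Rank functions of matroids

module MatroidRank {n} (K : RankedSet n) (isMatroid : IsMatroid K) where
  open IsMatroid isMatroid public
  private
    G : Subset n
    G = ground K
    r : Subset n → ℕ
    r = rank K

  rank-⊥ : r ⊥ ≡ 0
  rank-⊥ = n≤0⇒n≡0 (≤-trans (rank-≤-card ⊥ (⊆-min G)) (≤-reflexive (∣⊥∣≡0 n)))

  mono : ∀ {X Y} → X ⊆ Y → Y ⊆ G → r X ≤ r Y
  mono {X} {Y} = rank-mono X Y

  submod : ∀ {X Y} → X ⊆ G → Y ⊆ G → r (X ∪ Y) + r (X ∩ Y) ≤ r X + r Y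
  submod {X} {Y} = rank-submod X Y

  subadditive : ∀ {X Y} → X ⊆ G → Y ⊆ G → r (X ∪ Y) ≤ r X + r Y
  subadditive {X} {Y} X⊆G Y⊆G = m+n≤o⇒m≤o (r (X ∪ Y)) (submod X⊆G Y⊆G)

  rank-≤-cover : ∀ {Z X Y} → Z ⊆ X ∪ Y → X ⊆ G → Y ⊆ G → r Z ≤ r X + r Y
  rank-≤-cover Z⊆X∪Y X⊆G Y⊆G = ≤-trans (mono Z⊆X∪Y (∪-least X⊆G Y⊆G)) (subadditive X⊆G Y⊆G)

  rank-≤-cover-free : ∀ {Z X Y} → Z ⊆ X ∪ Y → X ⊆ G → Y ⊆ G → r Z ≤ r X + ∣ Y ∣
  rank-≤-cover-free {Y = Y} Z⊆X∪Y X⊆G Y⊆G =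
    ≤-trans (rank-≤-cover Z⊆X∪Y X⊆G Y⊆G) (+-monoʳ-≤ _ (rank-≤-card Y Y⊆G))

  isthmus-drops-rank : ∀ {e Y} → isthm K e → e ∈ Y → Y ⊆ G → r (Y - e) < r Y
  isthmus-drops-rank {e} {Y} (_ , drop) e∈Y Y⊆G = +-cancelʳ-< (r G) (r (Y - e)) (r Y) (begin-strict
      r (Y - e) + r G                  ≤⟨ +-mono-≤ (mono Y-e⊆Y∩G-e Y∩G-e⊆G) (mono G⊆Y∪G-e (∪-least Y⊆G G-e⊆G)) ⟩
      r (Y ∩ (G - e)) + r (Y ∪ (G - e)) ≡⟨ +-comm (r (Y ∩ (G - e))) _ ⟩
      r (Y ∪ (G - e)) + r (Y ∩ (G - e)) ≤⟨ submod Y⊆G G-e⊆G ⟩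
      r Y + r (G - e)                  <⟨ +-monoʳ-< (r Y) drop ⟩
      r Y + r G                        ∎)
    where
    open ≤-Reasoning
    E : Subset n
    E = ⁅ e ⁆
    G-e⊆G : G - e ⊆ G
    G-e⊆G = set-⊆ (𝟎 ─ᵉ 𝟏) 𝟎 (G ∷ E ∷ [])
    Y∩G-e⊆G : Y ∩ (G - e) ⊆ G
    Y∩G-e⊆G = set-⊆ (𝟏 ∩ᵉ (𝟎 ─ᵉ 𝟐)) 𝟎 (G ∷ Y ∷ E ∷ [])
    G⊆Y∪G-e : G ⊆ Y ∪ (G - e)
    G⊆Y∪G-e = subst (λ Q → G ⊆ Q ∪ (G - e)) (q⊆p⇒p∪q≡p (x∈p⇒⁅x⁆⊆p e∈Y))
                (set-⊆ 𝟎 ((𝟏 ∪ᵉ 𝟐) ∪ᵉ (𝟎 ─ᵉ 𝟐)) (G ∷ Y ∷ E ∷ []))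
    Y-e⊆Y∩G-e : Y - e ⊆ Y ∩ (G - e)
    Y-e⊆Y∩G-e = subst (λ Q → Q - e ⊆ Y ∩ (G - e)) (p⊆q⇒p∩q≡p Y⊆G)
                  (set-⊆ ((𝟏 ∩ᵉ 𝟎) ─ᵉ 𝟐) (𝟏 ∩ᵉ (𝟎 ─ᵉ 𝟐)) (G ∷ Y ∷ E ∷ []))

  private
    rank-─-isthmuses-by : ∀ {Z} → Z ⊆ₚ isthm K → ∀ k Y → ∣ Y ∩ Z ∣ ≡ k → Y ⊆ G → r (Y ─ Z) + k ≤ r Y
    rank-─-isthmuses-by {Z} _ zero Y _ Y⊆G =
      ≤-trans (≤-reflexive (+-identityʳ _)) (mono (set-⊆ (𝟎 ─ᵉ 𝟏) 𝟎 (Y ∷ Z ∷ [])) Y⊆G)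
    rank-─-isthmuses-by {Z} Z⊆I (suc k) Y ∣Y∩Z∣ Y⊆G with ∣p∣≡1+k⇒Nonempty (Y ∩ Z) ∣Y∩Z∣
    ... | e , e∈Y∩Z = begin
        r (Y ─ Z) + suc k       ≡⟨ +-suc (r (Y ─ Z)) k ⟩
        suc (r (Y ─ Z) + k)     ≤⟨ s≤s (+-monoˡ-≤ k (mono Y─Z⊆Y-e─Z Y-e─Z⊆G)) ⟩
        suc (r ((Y - e) ─ Z) + k) ≤⟨ s≤s (rank-─-isthmuses-by Z⊆I k (Y - e) ∣Y-e∩Z∣ Y-e⊆G) ⟩
        suc (r (Y - e))         ≤⟨ isthmus-drops-rank (Z⊆I e∈Z) e∈Y Y⊆G ⟩
        r Y                     ∎
      where
      open ≤-Reasoning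
      E : Subset n
      E = ⁅ e ⁆
      e∈Y : e ∈ Y
      e∈Y = proj₁ (x∈p∩q⁻ Y Z e∈Y∩Z)
      e∈Z : e ∈ Z
      e∈Z = proj₂ (x∈p∩q⁻ Y Z e∈Y∩Z)
      Y-e⊆G : Y - e ⊆ G
      Y-e⊆G x∈ = Y⊆G (set-⊆ (𝟎 ─ᵉ 𝟏) 𝟎 (Y ∷ E ∷ []) x∈)
      Y-e─Z⊆G : (Y - e) ─ Z ⊆ G
      Y-e─Z⊆G x∈ = Y⊆G (set-⊆ ((𝟎 ─ᵉ 𝟐) ─ᵉ 𝟏) 𝟎 (Y ∷ Z ∷ E ∷ []) x∈)
      Y─Z⊆Y-e─Z : Y ─ Z ⊆ (Y - e) ─ Z
      Y─Z⊆Y-e─Z = subst (λ Q → Y ─ Q ⊆ (Y - e) ─ Q) (q⊆p⇒p∪q≡p (x∈p⇒⁅x⁆⊆p e∈Z))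
                    (set-⊆ (𝟎 ─ᵉ (𝟏 ∪ᵉ 𝟐)) ((𝟎 ─ᵉ 𝟐) ─ᵉ (𝟏 ∪ᵉ 𝟐)) (Y ∷ Z ∷ E ∷ []))
      ∣Y-e∩Z∣ : ∣ (Y - e) ∩ Z ∣ ≡ k
      ∣Y-e∩Z∣ = suc-injective (begin-equality
        suc ∣ (Y - e) ∩ Z ∣  ≡⟨ cong (λ Q → suc ∣ Q ∣) (set-≡ ((𝟎 ─ᵉ 𝟐) ∩ᵉ 𝟏) ((𝟎 ∩ᵉ 𝟏) ─ᵉ 𝟐) (Y ∷ Z ∷ E ∷ [])) ⟩
        suc ∣ (Y ∩ Z) - e ∣  ≡⟨ sym (x∈p⇒∣p∣≡1+∣p-x∣ e∈Y∩Z) ⟩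
        ∣ Y ∩ Z ∣            ≡⟨ ∣Y∩Z∣ ⟩
        suc k                ∎)

    loops-rank-0-by : ∀ k Y → ∣ Y ∣ ≡ k → Y ⊆ₚ loops K → Y ⊆ G → r Y ≡ 0
    loops-rank-0-by zero Y ∣Y∣ _ _ = trans (cong r (∣p∣≡0⇒p≡⊥ ∣Y∣)) rank-⊥
    loops-rank-0-by (suc k) Y ∣Y∣ Y⊆L Y⊆G with ∣p∣≡1+k⇒Nonempty Y ∣Y∣
    ... | e , e∈Y = n≤0⇒n≡0 (begin
        r Y                ≤⟨ rank-≤-cover (set-⊆ 𝟎 ((𝟎 ─ᵉ 𝟏) ∪ᵉ 𝟏) (Y ∷ E ∷ [])) Y-e⊆G (x∈p⇒⁅x⁆⊆p (Y⊆G e∈Y)) ⟩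
        r (Y - e) + r E    ≡⟨ cong₂ _+_ (loops-rank-0-by k (Y - e) ∣Y-e∣ (λ x∈ → Y⊆L (Y-e⊆Y x∈)) Y-e⊆G)
                                        (proj₂ (Y⊆L e∈Y)) ⟩
        0                  ∎)
      where
      open ≤-Reasoning
      E : Subset n
      E = ⁅ e ⁆
      Y-e⊆Y : Y - e ⊆ Y
      Y-e⊆Y = set-⊆ (𝟎 ─ᵉ 𝟏) 𝟎 (Y ∷ E ∷ [])
      Y-e⊆G : Y - e ⊆ G
      Y-e⊆G x∈ = Y⊆G (Y-e⊆Y x∈)
      ∣Y-e∣ : ∣ Y - e ∣ ≡ k
      ∣Y-e∣ = suc-injective (trans (sym (x∈p⇒∣p∣≡1+∣p-x∣ e∈Y)) ∣Y∣)

  rank-─-isthmuses : ∀ {Z} → Z ⊆ₚ isthm K → ∀ Y → Y ⊆ G → r (Y ─ Z) + ∣ Y ∩ Z ∣ ≤ r Y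
  rank-─-isthmuses Z⊆I Y = rank-─-isthmuses-by Z⊆I _ Y refl

  loops-rank-0 : ∀ {Y} → Y ⊆ₚ loops K → Y ⊆ G → r Y ≡ 0
  loops-rank-0 {Y} = loops-rank-0-by _ Y refl

  loop-of-rank-0 : ∀ {Y e} → r Y ≡ 0 → Y ⊆ G → e ∈ Y → loops K e
  loop-of-rank-0 rY≡0 Y⊆G e∈Y = Y⊆G e∈Y , n≤0⇒n≡0 (≤-trans (mono (x∈p⇒⁅x⁆⊆p e∈Y) Y⊆G) (≤-reflexive rY≡0))

  isthmuses-of-free-extension : ∀ {Y Z} → G ⊆ Y ∪ Z → Y ⊆ G → Z ⊆ G → r Y + ∣ Z ∣ ≤ r G → Z ⊆ₚ isthm K
  isthmuses-of-free-extension {Y} {Z} G⊆Y∪Z Y⊆G Z⊆G free {e} e∈Z = Z⊆G e∈Z , (begin-strict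
      r (G - e)                ≤⟨ rank-≤-cover-free G-e⊆Y∪Z-e Y⊆G (λ x∈ → Z⊆G (Z-e⊆Z x∈)) ⟩
      r Y + ∣ Z - e ∣          <⟨ +-monoʳ-< (r Y) (n<1+n ∣ Z - e ∣) ⟩
      r Y + suc ∣ Z - e ∣      ≡⟨ cong (r Y +_) (sym (x∈p⇒∣p∣≡1+∣p-x∣ e∈Z)) ⟩
      r Y + ∣ Z ∣              ≤⟨ free ⟩
      r G                      ∎)
    where
    open ≤-Reasoning
    E : Subset n
    E = ⁅ e ⁆
    Z-e⊆Z : Z - e ⊆ Z
    Z-e⊆Z = set-⊆ (𝟎 ─ᵉ 𝟏) 𝟎 (Z ∷ E ∷ [])
    G-e⊆Y∪Z-e : G - e ⊆ Y ∪ (Z - e)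
    G-e⊆Y∪Z-e = subst (λ Q → Q - e ⊆ Y ∪ (Z - e)) (p⊆q⇒p∩q≡p G⊆Y∪Z)
      (set-⊆ ((𝟎 ∩ᵉ (𝟏 ∪ᵉ 𝟐)) ─ᵉ 𝟑) (𝟏 ∪ᵉ (𝟐 ─ᵉ 𝟑)) (G ∷ Y ∷ Z ∷ E ∷ []))

  loop⇒¬isthmus : ∀ {e} → loops K e → ¬ isthm K e
  loop⇒¬isthmus {e} (e∈G , r⁅e⁆≡0) (_ , drop) = <-irrefl refl (begin-strict
      r G                ≤⟨ rank-≤-cover (set-⊆ 𝟎 ((𝟎 ─ᵉ 𝟏) ∪ᵉ 𝟏) (G ∷ ⁅ e ⁆ ∷ []))
                                          (set-⊆ (𝟎 ─ᵉ 𝟏) 𝟎 (G ∷ ⁅ e ⁆ ∷ [])) (x∈p⇒⁅x⁆⊆p e∈G) ⟩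
      r (G - e) + r ⁅ e ⁆  ≡⟨ cong (r (G - e) +_) r⁅e⁆≡0 ⟩
      r (G - e) + 0      ≡⟨ +-identityʳ _ ⟩
      r (G - e)          <⟨ drop ⟩
      r G                ∎)
    where open ≤-Reasoning

RankMonotone : ∀ {n} → RankedSet n → Set
RankMonotone K = ∀ {X Y} → X ⊆ Y → Y ⊆ ground K → rank K X ≤ rank K Y

matched-rank : ∀ {n} (K L : RankedSet n) → RankMonotone K → Matched K L →
  ∀ Y → Y ⊆ ground K ∩ ground L →
  rank L Y + rank K (ground K ─ ground L) ≡ rank K (Y ∪ (ground K ─ ground L))
matched-rank {n} K L mono (_ , contraction≡restriction) Y Y⊆K∩L =
  trans (cong (_+ rank K (GK ─ GL)) (sym contracted)) (m∸n+n≡m shift≤)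
  where
  GK GL : Subset n
  GK = ground K
  GL = ground L
  contracted : rank K (Y ∪ (GK ─ GL)) ∸ rank K (GK ─ GL) ≡ rank L Y
  contracted = subst (λ Q → rank K (Y ∪ Q) ∸ rank K Q ≡ rank L Y)
                 (set-≡ (𝟎 ─ᵉ (𝟎 ∩ᵉ 𝟏)) (𝟎 ─ᵉ 𝟏) (GK ∷ GL ∷ []))
                 (contraction≡restriction Y Y⊆K∩L)
  shift≤ : rank K (GK ─ GL) ≤ rank K (Y ∪ (GK ─ GL))
  shift≤ = mono (set-⊆ 𝟏 (𝟎 ∪ᵉ 𝟏) (Y ∷ (GK ─ GL) ∷ []))
                (∪-least (λ x∈ → proj₁ (x∈p∩q⁻ GK GL (Y⊆K∩L x∈))) (set-⊆ (𝟎 ─ᵉ 𝟏) 𝟎 (GK ∷ GL ∷ [])))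

⊓-attained-left : ∀ {x y w} → x ⊓ y ≡ w → w < y → x ≡ w
⊓-attained-left {x} {y} x⊓y≡w w<y with ≤-total x y
... | inj₁ x≤y = trans (sym (m≤n⇒m⊓n≡m x≤y)) x⊓y≡w
... | inj₂ y≤x = ⊥-elim (<-irrefl refl (≤-<-trans (≤-reflexive (trans (sym (m≥n⇒m⊓n≡n y≤x)) x⊓y≡w)) w<y))

⊓-attained-right : ∀ {x y w} → x ⊓ y ≡ w → w < x → y ≡ w
⊓-attained-right {x} {y} x⊓y≡w = ⊓-attained-left (trans (⊓-comm y x) x⊓y≡w)

⊓-bounded-left : ∀ {x y w} → x ⊓ y ≤ w → w < y → x ≤ w
⊓-bounded-left {x} {y} x⊓y≤w w<y with ≤-total x y
... | inj₁ x≤y = ≤-trans (≤-reflexive (sym (m≤n⇒m⊓n≡m x≤y))) x⊓y≤w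
... | inj₂ y≤x = ⊥-elim (<-irrefl refl (≤-<-trans (≤-trans (≤-reflexive (sym (m≥n⇒m⊓n≡n y≤x))) x⊓y≤w) w<y))

-- The ranks of (M ⋈ N) ⋈ P and M ⋈ (N ⋈ P) unfold to minima of these shapes.
⊓-agree-when-l₄≡r₃ : ∀ l₁ l₂ l₃ l₄ r₂ r₃ → l₂ ≤ r₂ → l₄ ≡ r₃ → r₃ ≤ l₃ → r₂ ≤ l₂ ⊎ r₃ ≤ l₂ →
                     (l₁ ⊓ l₂) ⊓ (l₃ ⊓ l₄) ≡ l₁ ⊓ (r₂ ⊓ r₃)
⊓-agree-when-l₄≡r₃ l₁ l₂ l₃ l₄ r₂ r₃ l₂≤r₂ l₄≡r₃ r₃≤l₃ r≤l₂ = ≤-antisym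
  (⊓-glb lhs≤l₁ (⊓-glb (≤-trans (m⊓n≤m _ _) (≤-trans (m⊓n≤n l₁ l₂) l₂≤r₂))
                         (≤-trans (m⊓n≤n _ _) (≤-trans (m⊓n≤n l₃ l₄) (≤-reflexive l₄≡r₃)))))
  (⊓-glb (⊓-glb (m⊓n≤m _ _) (rhs≤l₂ r≤l₂))
         (⊓-glb (≤-trans rhs≤r₃ r₃≤l₃) (≤-trans rhs≤r₃ (≤-reflexive (sym l₄≡r₃)))))
  where
  lhs≤l₁ : (l₁ ⊓ l₂) ⊓ (l₃ ⊓ l₄) ≤ l₁
  lhs≤l₁ = ≤-trans (m⊓n≤m _ _) (m⊓n≤m l₁ l₂)
  rhs≤r₃ : l₁ ⊓ (r₂ ⊓ r₃) ≤ r₃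
  rhs≤r₃ = ≤-trans (m⊓n≤n l₁ _) (m⊓n≤n r₂ r₃)
  rhs≤l₂ : r₂ ≤ l₂ ⊎ r₃ ≤ l₂ → l₁ ⊓ (r₂ ⊓ r₃) ≤ l₂
  rhs≤l₂ (inj₁ r₂≤l₂) = ≤-trans (m⊓n≤n l₁ _) (≤-trans (m⊓n≤m r₂ r₃) r₂≤l₂)
  rhs≤l₂ (inj₂ r₃≤l₂) = ≤-trans rhs≤r₃ r₃≤l₂

⊓-agree-when-l₃≡r₃ : ∀ l₁ l₂ l₃ l₄ r₂ r₃ → l₃ ≡ r₃ → r₃ ≤ l₄ → l₁ ≤ l₂ → l₁ ≤ r₂ →
                     (l₁ ⊓ l₂) ⊓ (l₃ ⊓ l₄) ≡ l₁ ⊓ (r₂ ⊓ r₃)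
⊓-agree-when-l₃≡r₃ l₁ l₂ l₃ l₄ r₂ r₃ l₃≡r₃ r₃≤l₄ l₁≤l₂ l₁≤r₂ = ≤-antisym
  (⊓-glb (≤-trans (m⊓n≤m _ _) (m⊓n≤m l₁ l₂))
         (⊓-glb (≤-trans (m⊓n≤m _ _) (≤-trans (m⊓n≤m l₁ l₂) l₁≤r₂))
                (≤-trans (m⊓n≤n _ _) (≤-trans (m⊓n≤m l₃ l₄) (≤-reflexive l₃≡r₃)))))
  (⊓-glb (⊓-glb (m⊓n≤m _ _) (≤-trans (m⊓n≤m _ _) l₁≤l₂))
         (⊓-glb (≤-trans rhs≤r₃ (≤-reflexive (sym l₃≡r₃))) (≤-trans rhs≤r₃ r₃≤l₄)))
  where
  rhs≤r₃ : l₁ ⊓ (r₂ ⊓ r₃) ≤ r₃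
  rhs≤r₃ = ≤-trans (m⊓n≤n l₁ _) (m⊓n≤n r₂ r₃)

-- Associativity of the free splice

module SpliceAssociativity {n} (M N P : RankedSet n)
  (isM : IsMatroid M) (isN : IsMatroid N) (isP : IsMatroid P)
  (M~N : Matched M N) (MN~P : Matched (M ⋈ N) P) (N~P : Matched N P) (M~NP : Matched M (N ⋈ P))
  where

  A B C : Subset n
  A = ground M
  B = ground N
  C = ground P

  rM rN rP rMN : Subset n → ℕ
  rM = rank M
  rN = rank N
  rP = rank P
  rMN = rank (M ⋈ N)

  module RM = MatroidRank M isM
  module RN = MatroidRank N isN
  module RP = MatroidRank P isP

  env : Subset n → Subset n → Vec (Subset n) 5
  env X Y = A ∷ B ∷ C ∷ X ∷ Y ∷ []

  ABC : Vec (Subset n) 5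
  ABC = env ⊥ ⊥

  pattern 𝐀 = var zero
  pattern 𝐁 = var (suc zero)
  pattern 𝐂 = var (suc (suc zero))
  pattern 𝐗 = var (suc (suc (suc zero)))
  pattern 𝐘 = var (suc (suc (suc (suc zero))))

  rA∖B rA∖BC rB∖C : ℕ
  rA∖B = rM (A ─ B)
  rA∖BC = rM (A ─ (B ∪ C))
  rB∖C = rN (B ─ C)

  S T B∖AC AB∖C : Subset n
  S = (A ∩ C) ─ B
  T = A ∩ (B ∩ C)
  B∖AC = B ─ (A ∪ C)
  AB∖C = (B ─ C) ∩ A

  Condition : Set
  Condition = Empty S
            ⊎ (S ⊆ₚ isthm M × (B ─ A) ⊆ₚ isthm N)
            ⊎ (S ⊆ₚ loops P × (B ─ C) ⊆ₚ loops N)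
            ⊎ (B ⊆ A ∪ C × ((B ─ A) ⊆ₚ isthm N × (B ─ C) ⊆ₚ loops N) × ModularPair P S T)

  -- u ⊓ v is the rank of (A ∪ B) - C in M ⋈ N
  u v : ℕ
  u = rM (((A ∪ B) ─ C) ∩ A) + ∣ ((A ∪ B) ─ C) ─ A ∣
  v = rN (((A ∪ B) ─ C) ∩ B) + rA∖B

  rMN-mono : RankMonotone (M ⋈ N)
  rMN-mono {X} {Y} X⊆Y _ = ⊓-mono-≤
    (+-mono-≤ (RM.mono (∩-monoˡ-⊆ A X⊆Y) (set-⊆ (𝐗 ∩ᵉ 𝐀) 𝐀 (env Y ⊥)))
              (p⊆q⇒∣p∣≤∣q∣ (─-monoˡ-⊆ A X⊆Y)))
    (+-monoˡ-≤ rA∖B (RN.mono (∩-monoˡ-⊆ B X⊆Y) (set-⊆ (𝐗 ∩ᵉ 𝐁) 𝐁 (env Y ⊥))))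

  M~N-rank : ∀ Y → Y ⊆ A ∩ B → rN Y + rA∖B ≡ rM (Y ∪ (A ─ B))
  M~N-rank = matched-rank M N RM.mono M~N

  N~P-rank : ∀ Y → Y ⊆ B ∩ C → rP Y + rB∖C ≡ rN (Y ∪ (B ─ C))
  N~P-rank = matched-rank N P RN.mono N~P

  MN~P-rank : ∀ Y → Y ⊆ (A ∪ B) ∩ C → rP Y + rMN ((A ∪ B) ─ C) ≡ rMN (Y ∪ ((A ∪ B) ─ C))
  MN~P-rank = matched-rank (M ⋈ N) P rMN-mono MN~P

  M~NP-rank : ∀ Y → Y ⊆ A ∩ (B ∪ C) → rank (N ⋈ P) Y + rA∖BC ≡ rM (Y ∪ (A ─ (B ∪ C)))
  M~NP-rank = matched-rank M (N ⋈ P) RM.mono M~NP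

  v≡ : v ≡ rB∖C + rA∖B
  v≡ = cong (λ Q → rN Q + rA∖B) (set-≡ (((𝐀 ∪ᵉ 𝐁) ─ᵉ 𝐂) ∩ᵉ 𝐁) (𝐁 ─ᵉ 𝐂) ABC)

  u≡ : u ≡ rM (A ─ C) + ∣ B∖AC ∣
  u≡ = cong₂ (λ Q R → rM Q + ∣ R ∣) (set-≡ (((𝐀 ∪ᵉ 𝐁) ─ᵉ 𝐂) ∩ᵉ 𝐀) (𝐀 ─ᵉ 𝐂) ABC)
                                    (set-≡ (((𝐀 ∪ᵉ 𝐁) ─ᵉ 𝐂) ─ᵉ 𝐀) (𝐁 ─ᵉ (𝐀 ∪ᵉ 𝐂)) ABC)

  A─B⊆A : A ─ B ⊆ A
  A─B⊆A = set-⊆ (𝐀 ─ᵉ 𝐁) 𝐀 ABC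

  rA∖BC≤rA∖B : rA∖BC ≤ rA∖B
  rA∖BC≤rA∖B = RM.mono (set-⊆ (𝐀 ─ᵉ (𝐁 ∪ᵉ 𝐂)) (𝐀 ─ᵉ 𝐁) ABC) A─B⊆A

  rB∖C≤ : rB∖C ≤ rN AB∖C + ∣ B∖AC ∣
  rB∖C≤ = subst (λ R → rB∖C ≤ rN AB∖C + ∣ R ∣) (set-≡ ((𝐁 ─ᵉ 𝐂) ─ᵉ 𝐀) (𝐁 ─ᵉ (𝐀 ∪ᵉ 𝐂)) ABC)
            (RN.rank-≤-cover-free (set-⊆ (𝐁 ─ᵉ 𝐂) (((𝐁 ─ᵉ 𝐂) ∩ᵉ 𝐀) ∪ᵉ ((𝐁 ─ᵉ 𝐂) ─ᵉ 𝐀)) ABC)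
               (set-⊆ ((𝐁 ─ᵉ 𝐂) ∩ᵉ 𝐀) 𝐁 ABC) (set-⊆ ((𝐁 ─ᵉ 𝐂) ─ᵉ 𝐀) 𝐁 ABC))

  rN[AB∖C]+rA∖B≡ : rN AB∖C + rA∖B ≡ rM (AB∖C ∪ (A ─ B))
  rN[AB∖C]+rA∖B≡ = M~N-rank AB∖C (set-⊆ ((𝐁 ─ᵉ 𝐂) ∩ᵉ 𝐀) (𝐀 ∩ᵉ 𝐁) ABC)

  rA∖BC+rB∖C≤u : rA∖BC + rB∖C ≤ u
  rA∖BC+rB∖C≤u = begin
      rA∖BC + rB∖C                  ≤⟨ +-monoʳ-≤ rA∖BC rB∖C≤ ⟩
      rA∖BC + (rN AB∖C + ∣ B∖AC ∣)  ≡⟨ sym (+-assoc rA∖BC (rN AB∖C) _) ⟩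
      rA∖BC + rN AB∖C + ∣ B∖AC ∣    ≤⟨ +-monoˡ-≤ ∣ B∖AC ∣ rA∖BC+rN[AB∖C]≤ ⟩
      rM (A ─ C) + ∣ B∖AC ∣         ≡⟨ sym u≡ ⟩
      u                             ∎
    where
    open ≤-Reasoning
    submodular : rM (AB∖C ∪ (A ─ B)) + rA∖BC ≤ rM (A ─ C) + rA∖B
    submodular = subst₂ (λ U I → rM U + rM I ≤ rM (A ─ C) + rA∖B)
                   (set-≡ ((𝐀 ─ᵉ 𝐂) ∪ᵉ (𝐀 ─ᵉ 𝐁)) (((𝐁 ─ᵉ 𝐂) ∩ᵉ 𝐀) ∪ᵉ (𝐀 ─ᵉ 𝐁)) ABC)
                   (set-≡ ((𝐀 ─ᵉ 𝐂) ∩ᵉ (𝐀 ─ᵉ 𝐁)) (𝐀 ─ᵉ (𝐁 ∪ᵉ 𝐂)) ABC)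
                   (RM.submod (set-⊆ (𝐀 ─ᵉ 𝐂) 𝐀 ABC) A─B⊆A)
    rA∖BC+rN[AB∖C]≤ : rA∖BC + rN AB∖C ≤ rM (A ─ C)
    rA∖BC+rN[AB∖C]≤ = +-cancelʳ-≤ rA∖B _ _ (begin
      rA∖BC + rN AB∖C + rA∖B      ≡⟨ trans (+-assoc rA∖BC _ _) (+-comm rA∖BC _) ⟩
      (rN AB∖C + rA∖B) + rA∖BC    ≡⟨ cong (_+ rA∖BC) rN[AB∖C]+rA∖B≡ ⟩
      rM (AB∖C ∪ (A ─ B)) + rA∖BC ≤⟨ submodular ⟩
      rM (A ─ C) + rA∖B           ∎)

  S⊆A : S ⊆ A
  S⊆A = set-⊆ ((𝐀 ∩ᵉ 𝐂) ─ᵉ 𝐁) 𝐀 ABC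

  S⊆C : S ⊆ C
  S⊆C = set-⊆ ((𝐀 ∩ᵉ 𝐂) ─ᵉ 𝐁) 𝐂 ABC

  rA∖B≤rA∖BC+∣S∣ : rA∖B ≤ rA∖BC + ∣ S ∣
  rA∖B≤rA∖BC+∣S∣ = RM.rank-≤-cover-free (set-⊆ (𝐀 ─ᵉ 𝐁) ((𝐀 ─ᵉ (𝐁 ∪ᵉ 𝐂)) ∪ᵉ ((𝐀 ∩ᵉ 𝐂) ─ᵉ 𝐁)) ABC)
                     (set-⊆ (𝐀 ─ᵉ (𝐁 ∪ᵉ 𝐂)) 𝐀 ABC) S⊆A

  rA∖B≡ : rA∖B ≡ rA∖BC + (∣ S ∣ ⊓ (rP S + rB∖C))
  rA∖B≡ = begin-equality
    rA∖B                                        ≡⟨ cong rM (set-≡ (𝐀 ─ᵉ 𝐁) (((𝐀 ∩ᵉ 𝐂) ─ᵉ 𝐁) ∪ᵉ (𝐀 ─ᵉ (𝐁 ∪ᵉ 𝐂))) ABC) ⟩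
    rM (S ∪ (A ─ (B ∪ C)))                      ≡⟨ sym (M~NP-rank S (set-⊆ ((𝐀 ∩ᵉ 𝐂) ─ᵉ 𝐁) (𝐀 ∩ᵉ (𝐁 ∪ᵉ 𝐂)) ABC)) ⟩
    rank (N ⋈ P) S + rA∖BC                      ≡⟨ cong (_+ rA∖BC) rNP[S]≡ ⟩
    (∣ S ∣ ⊓ (rP S + rB∖C)) + rA∖BC             ≡⟨ +-comm _ rA∖BC ⟩
    rA∖BC + (∣ S ∣ ⊓ (rP S + rB∖C))             ∎
    where
    open ≤-Reasoning
    rNP[S]≡ : rank (N ⋈ P) S ≡ ∣ S ∣ ⊓ (rP S + rB∖C)
    rNP[S]≡ = cong₂ _⊓_
      (cong₂ _+_ (trans (cong rN (set-≡ (((𝐀 ∩ᵉ 𝐂) ─ᵉ 𝐁) ∩ᵉ 𝐁) ∅ᵉ ABC)) RN.rank-⊥)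
                 (cong ∣_∣ (set-≡ (((𝐀 ∩ᵉ 𝐂) ─ᵉ 𝐁) ─ᵉ 𝐁) ((𝐀 ∩ᵉ 𝐂) ─ᵉ 𝐁) ABC)))
      (cong (λ R → rP R + rB∖C) (set-≡ (((𝐀 ∩ᵉ 𝐂) ─ᵉ 𝐁) ∩ᵉ 𝐂) ((𝐀 ∩ᵉ 𝐂) ─ᵉ 𝐁) ABC))

  rP[S]+u⊓v≡ : rP S + (u ⊓ v) ≡ rB∖C + rA∖B
  rP[S]+u⊓v≡ = begin-equality
    rP S + (u ⊓ v)                              ≡⟨ MN~P-rank S (set-⊆ ((𝐀 ∩ᵉ 𝐂) ─ᵉ 𝐁) ((𝐀 ∪ᵉ 𝐁) ∩ᵉ 𝐂) ABC) ⟩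
    rMN Z                                       ≡⟨ m≥n⇒m⊓n≡n N-side≤M-side ⟩
    rN (Z ∩ B) + rA∖B                           ≡⟨ Z∩B-side ⟩
    rB∖C + rA∖B                                 ∎
    where
    open ≤-Reasoning
    Z : Subset n
    Z = S ∪ ((A ∪ B) ─ C)
    Z∩B-side : rN (Z ∩ B) + rA∖B ≡ rB∖C + rA∖B
    Z∩B-side = cong (λ R → rN R + rA∖B) (set-≡ ((((𝐀 ∩ᵉ 𝐂) ─ᵉ 𝐁) ∪ᵉ ((𝐀 ∪ᵉ 𝐁) ─ᵉ 𝐂)) ∩ᵉ 𝐁) (𝐁 ─ᵉ 𝐂) ABC)
    N-side≤M-side : rN (Z ∩ B) + rA∖B ≤ rM (Z ∩ A) + ∣ Z ─ A ∣
    N-side≤M-side = begin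
      rN (Z ∩ B) + rA∖B               ≡⟨ Z∩B-side ⟩
      rB∖C + rA∖B                     ≤⟨ +-monoˡ-≤ rA∖B rB∖C≤ ⟩
      rN AB∖C + ∣ B∖AC ∣ + rA∖B       ≡⟨ xy∙z≈xz∙y (rN AB∖C) ∣ B∖AC ∣ rA∖B ⟩
      rN AB∖C + rA∖B + ∣ B∖AC ∣       ≡⟨ cong₂ _+_
          (trans rN[AB∖C]+rA∖B≡ (cong rM (set-≡ (((𝐁 ─ᵉ 𝐂) ∩ᵉ 𝐀) ∪ᵉ (𝐀 ─ᵉ 𝐁))
                                                ((((𝐀 ∩ᵉ 𝐂) ─ᵉ 𝐁) ∪ᵉ ((𝐀 ∪ᵉ 𝐁) ─ᵉ 𝐂)) ∩ᵉ 𝐀) ABC)))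
          (cong ∣_∣ (set-≡ (𝐁 ─ᵉ (𝐀 ∪ᵉ 𝐂)) ((((𝐀 ∩ᵉ 𝐂) ─ᵉ 𝐁) ∪ᵉ ((𝐀 ∪ᵉ 𝐁) ─ᵉ 𝐂)) ─ᵉ 𝐀) ABC)) ⟩
      rM (Z ∩ A) + ∣ Z ─ A ∣          ∎

  L R : RankedSet n
  L = (M ⋈ N) ⋈ P
  R = M ⋈ (N ⋈ P)

  E : Subset n
  E = (A ∪ B) ∪ C

  l₁ l₂ l₃ l₄ r₂ r₃ : Subset n → ℕ
  l₁ X = rM (X ∩ A) + ∣ X ─ A ∣
  l₂ X = (rN ((X ∩ (A ∪ B)) ∩ B) + rA∖B) + ∣ X ─ (A ∪ B) ∣
  l₃ X = rP (X ∩ C) + u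
  l₄ X = rP (X ∩ C) + v
  r₂ X = (rN ((X ∩ (B ∪ C)) ∩ B) + ∣ (X ∩ (B ∪ C)) ─ B ∣) + rA∖BC
  r₃ X = (rP ((X ∩ (B ∪ C)) ∩ C) + rB∖C) + rA∖BC

  rank-L≡ : ∀ X → rank L X ≡ (l₁ X ⊓ l₂ X) ⊓ (l₃ X ⊓ l₄ X)
  rank-L≡ X = cong₂ _⊓_
    (trans (+-distribʳ-⊓ ∣ X ─ (A ∪ B) ∣ (rM ((X ∩ (A ∪ B)) ∩ A) + ∣ (X ∩ (A ∪ B)) ─ A ∣) _)
           (cong (_⊓ l₂ X) first-term≡l₁))
    (+-distribˡ-⊓ (rP (X ∩ C)) u v)
    where
    first-term≡l₁ : (rM ((X ∩ (A ∪ B)) ∩ A) + ∣ (X ∩ (A ∪ B)) ─ A ∣) + ∣ X ─ (A ∪ B) ∣ ≡ l₁ X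
    first-term≡l₁ = trans (+-assoc (rM ((X ∩ (A ∪ B)) ∩ A)) _ _)
      (cong₂ _+_ (cong rM (set-≡ ((𝐗 ∩ᵉ (𝐀 ∪ᵉ 𝐁)) ∩ᵉ 𝐀) (𝐗 ∩ᵉ 𝐀) (env X ⊥)))
                 (sym (trans (∣p∣≡∣p∩q∣+∣p─q∣ (X ─ A) (A ∪ B))
                    (cong₂ (λ U W → ∣ U ∣ + ∣ W ∣)
                           (set-≡ ((𝐗 ─ᵉ 𝐀) ∩ᵉ (𝐀 ∪ᵉ 𝐁)) ((𝐗 ∩ᵉ (𝐀 ∪ᵉ 𝐁)) ─ᵉ 𝐀) (env X ⊥))
                           (set-≡ ((𝐗 ─ᵉ 𝐀) ─ᵉ (𝐀 ∪ᵉ 𝐁)) (𝐗 ─ᵉ (𝐀 ∪ᵉ 𝐁)) (env X ⊥))))))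

  rank-R≡ : ∀ X → rank R X ≡ l₁ X ⊓ (r₂ X ⊓ r₃ X)
  rank-R≡ X = cong (l₁ X ⊓_) (+-distribʳ-⊓ rA∖BC _ _)

  L≅R-from-terms : (∀ X → X ⊆ E → (l₁ X ⊓ l₂ X) ⊓ (l₃ X ⊓ l₄ X) ≡ l₁ X ⊓ (r₂ X ⊓ r₃ X)) → L ≅ R
  L≅R-from-terms terms-agree =
    set-≡ ((𝐀 ∪ᵉ 𝐁) ∪ᵉ 𝐂) (𝐀 ∪ᵉ (𝐁 ∪ᵉ 𝐂)) ABC ,
    λ X X⊆E → trans (rank-L≡ X) (trans (terms-agree X X⊆E) (sym (rank-R≡ X)))

  r₃≡ : ∀ X → r₃ X ≡ rP (X ∩ C) + (rB∖C + rA∖BC)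
  r₃≡ X = trans (cong (λ R → (rP R + rB∖C) + rA∖BC) (set-≡ ((𝐗 ∩ᵉ (𝐁 ∪ᵉ 𝐂)) ∩ᵉ 𝐂) (𝐗 ∩ᵉ 𝐂) (env X ⊥)))
                (+-assoc (rP (X ∩ C)) _ _)

  r₃≤l₃ : ∀ X → r₃ X ≤ l₃ X
  r₃≤l₃ X = ≤-trans (≤-reflexive (r₃≡ X))
              (+-monoʳ-≤ (rP (X ∩ C)) (≤-trans (≤-reflexive (+-comm rB∖C rA∖BC)) rA∖BC+rB∖C≤u))

  r₃≤l₄ : ∀ X → r₃ X ≤ l₄ X
  r₃≤l₄ X = ≤-trans (≤-reflexive (r₃≡ X))
              (+-monoʳ-≤ (rP (X ∩ C)) (≤-trans (+-monoʳ-≤ rB∖C rA∖BC≤rA∖B) (≤-reflexive (sym v≡))))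

  l₄≡r₃ : rA∖B ≡ rA∖BC → ∀ X → l₄ X ≡ r₃ X
  l₄≡r₃ rA∖B≡rA∖BC X = trans (cong (rP (X ∩ C) +_) (trans v≡ (cong (rB∖C +_) rA∖B≡rA∖BC))) (sym (r₃≡ X))

  l₂≡′ : ∀ X → l₂ X ≡ (rN (X ∩ B) + rA∖B) + ∣ X ─ (A ∪ B) ∣
  l₂≡′ X = cong (λ Q → (rN Q + rA∖B) + ∣ X ─ (A ∪ B) ∣) (set-≡ ((𝐗 ∩ᵉ (𝐀 ∪ᵉ 𝐁)) ∩ᵉ 𝐁) (𝐗 ∩ᵉ 𝐁) (env X ⊥))

  l₂≡ : rA∖B ≡ rA∖BC → ∀ X → l₂ X ≡ (rN (X ∩ B) + ∣ X ─ (A ∪ B) ∣) + rA∖BC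
  l₂≡ rA∖B≡rA∖BC X = begin-equality
    l₂ X                                            ≡⟨ l₂≡′ X ⟩
    (rN (X ∩ B) + rA∖B) + ∣ X ─ (A ∪ B) ∣          ≡⟨ xy∙z≈xz∙y (rN (X ∩ B)) rA∖B _ ⟩
    (rN (X ∩ B) + ∣ X ─ (A ∪ B) ∣) + rA∖B          ≡⟨ cong ((rN (X ∩ B) + ∣ X ─ (A ∪ B) ∣) +_) rA∖B≡rA∖BC ⟩
    (rN (X ∩ B) + ∣ X ─ (A ∪ B) ∣) + rA∖BC         ∎
    where open ≤-Reasoning

  r₂≡ : ∀ X → r₂ X ≡ (rN (X ∩ B) + ∣ (X ∩ (B ∪ C)) ─ B ∣) + rA∖BC
  r₂≡ X = cong (λ Q → (rN Q + ∣ (X ∩ (B ∪ C)) ─ B ∣) + rA∖BC)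
               (set-≡ ((𝐗 ∩ᵉ (𝐁 ∪ᵉ 𝐂)) ∩ᵉ 𝐁) (𝐗 ∩ᵉ 𝐁) (env X ⊥))

  X─AB⊆X∩BC─B : ∀ {X} → X ⊆ E → X ─ (A ∪ B) ⊆ (X ∩ (B ∪ C)) ─ B
  X─AB⊆X∩BC─B {X} X⊆E = subst (λ Q → Q ─ (A ∪ B) ⊆ (Q ∩ (B ∪ C)) ─ B) (p⊆q⇒p∩q≡p X⊆E)
    (set-⊆ ((𝐗 ∩ᵉ ((𝐀 ∪ᵉ 𝐁) ∪ᵉ 𝐂)) ─ᵉ (𝐀 ∪ᵉ 𝐁)) (((𝐗 ∩ᵉ ((𝐀 ∪ᵉ 𝐁) ∪ᵉ 𝐂)) ∩ᵉ (𝐁 ∪ᵉ 𝐂)) ─ᵉ 𝐁) (env X ⊥))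

  l₂≤r₂ : rA∖B ≡ rA∖BC → ∀ {X} → X ⊆ E → l₂ X ≤ r₂ X
  l₂≤r₂ rA∖B≡rA∖BC {X} X⊆E = ≤-trans (≤-reflexive (l₂≡ rA∖B≡rA∖BC X))
    (≤-trans (+-monoˡ-≤ rA∖BC (+-monoʳ-≤ (rN (X ∩ B)) (p⊆q⇒∣p∣≤∣q∣ (X─AB⊆X∩BC─B X⊆E))))
             (≤-reflexive (sym (r₂≡ X))))

  S≡∅⇒L≅R : S ≡ ⊥ → L ≅ R
  S≡∅⇒L≅R S≡∅ = L≅R-from-terms λ X X⊆E →
    ⊓-agree-when-l₄≡r₃ (l₁ X) (l₂ X) (l₃ X) (l₄ X) (r₂ X) (r₃ X)
      (l₂≤r₂ rA∖B≡rA∖BC X⊆E) (l₄≡r₃ rA∖B≡rA∖BC X) (r₃≤l₃ X) (inj₁ (r₂≤l₂ X X⊆E))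
    where
    ∣S∣≡0 : ∣ S ∣ ≡ 0
    ∣S∣≡0 = trans (cong ∣_∣ S≡∅) (∣⊥∣≡0 n)
    rA∖B≡rA∖BC : rA∖B ≡ rA∖BC
    rA∖B≡rA∖BC = ≤-antisym
      (≤-trans rA∖B≤rA∖BC+∣S∣ (≤-reflexive (trans (cong (rA∖BC +_) ∣S∣≡0) (+-identityʳ rA∖BC))))
      rA∖BC≤rA∖B
    -- outside B, a point of X ∩ (B ∪ C) in A would lie in S
    ∣X∩BC─B∣≤∣X─AB∣ : ∀ X → X ⊆ E → ∣ (X ∩ (B ∪ C)) ─ B ∣ ≤ ∣ X ─ (A ∪ B) ∣
    ∣X∩BC─B∣≤∣X─AB∣ X X⊆E = ≤-reflexive (trans (∣p∣≡∣p∩q∣+∣p─q∣ ((X ∩ (B ∪ C)) ─ B) A) (cong₂ _+_ in-A out-A))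
      where
      in-A : ∣ ((X ∩ (B ∪ C)) ─ B) ∩ A ∣ ≡ 0
      in-A = n≤0⇒n≡0 (≤-trans (p⊆q⇒∣p∣≤∣q∣ (set-⊆ (((𝐗 ∩ᵉ (𝐁 ∪ᵉ 𝐂)) ─ᵉ 𝐁) ∩ᵉ 𝐀) ((𝐀 ∩ᵉ 𝐂) ─ᵉ 𝐁) (env X ⊥)))
                              (≤-reflexive ∣S∣≡0))
      out-A : ∣ ((X ∩ (B ∪ C)) ─ B) ─ A ∣ ≡ ∣ X ─ (A ∪ B) ∣
      out-A = cong ∣_∣ (subst (λ Q → ((Q ∩ (B ∪ C)) ─ B) ─ A ≡ Q ─ (A ∪ B)) (p⊆q⇒p∩q≡p X⊆E)
        (set-≡ (((𝐗 ∩ᵉ ((𝐀 ∪ᵉ 𝐁) ∪ᵉ 𝐂)) ∩ᵉ (𝐁 ∪ᵉ 𝐂)) ─ᵉ 𝐁 ─ᵉ 𝐀) ((𝐗 ∩ᵉ ((𝐀 ∪ᵉ 𝐁) ∪ᵉ 𝐂)) ─ᵉ (𝐀 ∪ᵉ 𝐁)) (env X ⊥)))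
    r₂≤l₂ : ∀ X → X ⊆ E → r₂ X ≤ l₂ X
    r₂≤l₂ X X⊆E = ≤-trans (≤-reflexive (r₂≡ X))
      (≤-trans (+-monoˡ-≤ rA∖BC (+-monoʳ-≤ (rN (X ∩ B)) (∣X∩BC─B∣≤∣X─AB∣ X X⊆E)))
               (≤-reflexive (sym (l₂≡ rA∖B≡rA∖BC X))))

  B─C⊆B : B ─ C ⊆ B
  B─C⊆B = set-⊆ (𝐁 ─ᵉ 𝐂) 𝐁 ABC

  rP≤rN : ∀ {Y} → Y ⊆ B ∩ C → rP Y ≤ rN Y
  rP≤rN {Y} Y⊆B∩C = +-cancelʳ-≤ rB∖C _ _
    (≤-trans (≤-reflexive (N~P-rank Y Y⊆B∩C))
             (RN.subadditive (λ x∈ → proj₁ (x∈p∩q⁻ B C (Y⊆B∩C x∈))) B─C⊆B))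

  loops⇒L≅R : S ⊆ₚ loops P → (B ─ C) ⊆ₚ loops N → L ≅ R
  loops⇒L≅R S⊆loops B─C⊆loops = L≅R-from-terms λ X X⊆E →
    ⊓-agree-when-l₄≡r₃ (l₁ X) (l₂ X) (l₃ X) (l₄ X) (r₂ X) (r₃ X)
      (l₂≤r₂ rA∖B≡rA∖BC X⊆E) (l₄≡r₃ rA∖B≡rA∖BC X) (r₃≤l₃ X) (inj₂ (r₃≤l₂ X))
    where
    open ≤-Reasoning
    rB∖C≡0 : rB∖C ≡ 0
    rB∖C≡0 = RN.loops-rank-0 B─C⊆loops B─C⊆B
    rP[⊆S]≡0 : ∀ {Y} → Y ⊆ S → rP Y ≡ 0
    rP[⊆S]≡0 Y⊆S = RP.loops-rank-0 (λ x∈ → S⊆loops (Y⊆S x∈)) (λ x∈ → S⊆C (Y⊆S x∈))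
    rA∖B≡rA∖BC : rA∖B ≡ rA∖BC
    rA∖B≡rA∖BC = ≤-antisym (begin
      rA∖B                                ≡⟨ rA∖B≡ ⟩
      rA∖BC + (∣ S ∣ ⊓ (rP S + rB∖C))     ≤⟨ +-monoʳ-≤ rA∖BC (m⊓n≤n ∣ S ∣ _) ⟩
      rA∖BC + (rP S + rB∖C)               ≡⟨ cong (rA∖BC +_) (cong₂ _+_ (rP[⊆S]≡0 (λ x∈ → x∈)) rB∖C≡0) ⟩
      rA∖BC + 0                           ≡⟨ +-identityʳ rA∖BC ⟩
      rA∖BC                               ∎) rA∖BC≤rA∖B
    rP[X∩C]≤ : ∀ X → rP (X ∩ C) ≤ rN (X ∩ B) + ∣ X ─ (A ∪ B) ∣
    rP[X∩C]≤ X = begin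
      rP (X ∩ C)                                       ≤⟨ RP.rank-≤-cover-free
          (set-⊆ (𝐗 ∩ᵉ 𝐂) (((𝐗 ∩ᵉ (𝐁 ∩ᵉ 𝐂)) ∪ᵉ (𝐗 ∩ᵉ ((𝐀 ∩ᵉ 𝐂) ─ᵉ 𝐁))) ∪ᵉ ((𝐗 ∩ᵉ 𝐂) ─ᵉ (𝐀 ∪ᵉ 𝐁))) (env X ⊥))
          (∪-least X∩B∩C⊆C X∩S⊆C) (set-⊆ ((𝐗 ∩ᵉ 𝐂) ─ᵉ (𝐀 ∪ᵉ 𝐁)) 𝐂 (env X ⊥)) ⟩
      rP ((X ∩ (B ∩ C)) ∪ (X ∩ S)) + ∣ (X ∩ C) ─ (A ∪ B) ∣
          ≤⟨ +-mono-≤ (RP.subadditive X∩B∩C⊆C X∩S⊆C)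
                      (p⊆q⇒∣p∣≤∣q∣ (set-⊆ ((𝐗 ∩ᵉ 𝐂) ─ᵉ (𝐀 ∪ᵉ 𝐁)) (𝐗 ─ᵉ (𝐀 ∪ᵉ 𝐁)) (env X ⊥))) ⟩
      (rP (X ∩ (B ∩ C)) + rP (X ∩ S)) + ∣ X ─ (A ∪ B) ∣
          ≡⟨ cong (λ z → (rP (X ∩ (B ∩ C)) + z) + ∣ X ─ (A ∪ B) ∣)
                  (rP[⊆S]≡0 (set-⊆ (𝐗 ∩ᵉ ((𝐀 ∩ᵉ 𝐂) ─ᵉ 𝐁)) ((𝐀 ∩ᵉ 𝐂) ─ᵉ 𝐁) (env X ⊥))) ⟩
      (rP (X ∩ (B ∩ C)) + 0) + ∣ X ─ (A ∪ B) ∣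
          ≡⟨ cong (_+ ∣ X ─ (A ∪ B) ∣) (+-identityʳ _) ⟩
      rP (X ∩ (B ∩ C)) + ∣ X ─ (A ∪ B) ∣
          ≤⟨ +-monoˡ-≤ ∣ X ─ (A ∪ B) ∣ (≤-trans (rP≤rN (set-⊆ (𝐗 ∩ᵉ (𝐁 ∩ᵉ 𝐂)) (𝐁 ∩ᵉ 𝐂) (env X ⊥)))
                (RN.mono (set-⊆ (𝐗 ∩ᵉ (𝐁 ∩ᵉ 𝐂)) (𝐗 ∩ᵉ 𝐁) (env X ⊥)) (set-⊆ (𝐗 ∩ᵉ 𝐁) 𝐁 (env X ⊥)))) ⟩
      rN (X ∩ B) + ∣ X ─ (A ∪ B) ∣                     ∎
      where
      X∩B∩C⊆C : X ∩ (B ∩ C) ⊆ C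
      X∩B∩C⊆C = set-⊆ (𝐗 ∩ᵉ (𝐁 ∩ᵉ 𝐂)) 𝐂 (env X ⊥)
      X∩S⊆C : X ∩ S ⊆ C
      X∩S⊆C = set-⊆ (𝐗 ∩ᵉ ((𝐀 ∩ᵉ 𝐂) ─ᵉ 𝐁)) 𝐂 (env X ⊥)
    r₃≤l₂ : ∀ X → r₃ X ≤ l₂ X
    r₃≤l₂ X = begin
      r₃ X                                         ≡⟨ r₃≡ X ⟩
      rP (X ∩ C) + (rB∖C + rA∖BC)                  ≡⟨ cong (λ z → rP (X ∩ C) + (z + rA∖BC)) rB∖C≡0 ⟩
      rP (X ∩ C) + rA∖BC                           ≤⟨ +-monoˡ-≤ rA∖BC (rP[X∩C]≤ X) ⟩
      (rN (X ∩ B) + ∣ X ─ (A ∪ B) ∣) + rA∖BC       ≡⟨ sym (l₂≡ rA∖B≡rA∖BC X) ⟩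
      l₂ X                                         ∎

  A─S⊆A : A ─ S ⊆ A
  A─S⊆A = set-⊆ (𝐀 ─ᵉ ((𝐀 ∩ᵉ 𝐂) ─ᵉ 𝐁)) 𝐀 ABC

  A∩B⊆B : A ∩ B ⊆ B
  A∩B⊆B = set-⊆ (𝐀 ∩ᵉ 𝐁) 𝐁 ABC

  rN[A∩B]+rA∖B≡rM[A] : rN (A ∩ B) + rA∖B ≡ rM A
  rN[A∩B]+rA∖B≡rM[A] = trans (M~N-rank (A ∩ B) (λ x∈ → x∈)) (cong rM (set-≡ ((𝐀 ∩ᵉ 𝐁) ∪ᵉ (𝐀 ─ᵉ 𝐁)) 𝐀 ABC))

  rM[A]+rA∖BC≤ : rM A + rA∖BC ≤ rM (A ─ S) + rA∖B
  rM[A]+rA∖BC≤ = subst₂ (λ U W → rM U + rM W ≤ rM (A ─ S) + rA∖B)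
    (set-≡ ((𝐀 ─ᵉ ((𝐀 ∩ᵉ 𝐂) ─ᵉ 𝐁)) ∪ᵉ (𝐀 ─ᵉ 𝐁)) 𝐀 ABC)
    (set-≡ ((𝐀 ─ᵉ ((𝐀 ∩ᵉ 𝐂) ─ᵉ 𝐁)) ∩ᵉ (𝐀 ─ᵉ 𝐁)) (𝐀 ─ᵉ (𝐁 ∪ᵉ 𝐂)) ABC)
    (RM.submod A─S⊆A A─B⊆A)

  rN[B]≤ : rN B ≤ rN (A ∩ B) + ∣ B ─ A ∣
  rN[B]≤ = RN.rank-≤-cover-free (set-⊆ 𝐁 ((𝐀 ∩ᵉ 𝐁) ∪ᵉ (𝐁 ─ᵉ 𝐀)) ABC) A∩B⊆B (set-⊆ (𝐁 ─ᵉ 𝐀) 𝐁 ABC)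

  rA∖BC+rB∖C<v : rA∖BC < rA∖B → rA∖BC + rB∖C < v
  rA∖BC+rB∖C<v rA∖BC<rA∖B = begin-strict
    rA∖BC + rB∖C   ≡⟨ +-comm rA∖BC rB∖C ⟩
    rB∖C + rA∖BC   <⟨ +-monoʳ-< rB∖C rA∖BC<rA∖B ⟩
    rB∖C + rA∖B    ≡⟨ sym v≡ ⟩
    v              ∎
    where open ≤-Reasoning

  ∣X─A∣≡ : ∀ X → ∣ X ─ A ∣ ≡ ∣ (X ∩ B) ─ A ∣ + ∣ X ─ (A ∪ B) ∣
  ∣X─A∣≡ X = trans (∣p∣≡∣p∩q∣+∣p─q∣ (X ─ A) B)
    (cong₂ (λ U W → ∣ U ∣ + ∣ W ∣) (set-≡ ((𝐗 ─ᵉ 𝐀) ∩ᵉ 𝐁) ((𝐗 ∩ᵉ 𝐁) ─ᵉ 𝐀) (env X ⊥))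
                                  (set-≡ ((𝐗 ─ᵉ 𝐀) ─ᵉ 𝐁) (𝐗 ─ᵉ (𝐀 ∪ᵉ 𝐁)) (env X ⊥)))

  module Tight (u≤ : u ≤ rA∖BC + rB∖C) (rA∖BC<rA∖B : rA∖BC < rA∖B) where
    open ≤-Reasoning

    u-tight : u ≡ rA∖BC + rB∖C
    u-tight = ≤-antisym u≤ rA∖BC+rB∖C≤u

    u⊓v≡ : u ⊓ v ≡ rA∖BC + rB∖C
    u⊓v≡ = trans (m≤n⇒m⊓n≡m (<⇒≤ (≤-<-trans u≤ (rA∖BC+rB∖C<v rA∖BC<rA∖B)))) u-tight

    rM[A─S]+∣B─A∣≡ : rM (A ─ S) + ∣ B ─ A ∣ ≡ rN B + rA∖BC
    rM[A─S]+∣B─A∣≡ = ⊓-attained-left rMN[Z]≡ (+-monoʳ-< (rN B) rA∖BC<rA∖B)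
      where
      Z : Subset n
      Z = (B ∩ C) ∪ ((A ∪ B) ─ C)
      rMN[Z]≡ : (rM (A ─ S) + ∣ B ─ A ∣) ⊓ (rN B + rA∖B) ≡ rN B + rA∖BC
      rMN[Z]≡ = begin-equality
        (rM (A ─ S) + ∣ B ─ A ∣) ⊓ (rN B + rA∖B)
            ≡⟨ sym (cong₂ _⊓_ (cong₂ (λ U W → rM U + ∣ W ∣)
                 (set-≡ (((𝐁 ∩ᵉ 𝐂) ∪ᵉ ((𝐀 ∪ᵉ 𝐁) ─ᵉ 𝐂)) ∩ᵉ 𝐀) (𝐀 ─ᵉ ((𝐀 ∩ᵉ 𝐂) ─ᵉ 𝐁)) ABC)
                 (set-≡ (((𝐁 ∩ᵉ 𝐂) ∪ᵉ ((𝐀 ∪ᵉ 𝐁) ─ᵉ 𝐂)) ─ᵉ 𝐀) (𝐁 ─ᵉ 𝐀) ABC))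
                 (cong (λ U → rN U + rA∖B) (set-≡ (((𝐁 ∩ᵉ 𝐂) ∪ᵉ ((𝐀 ∪ᵉ 𝐁) ─ᵉ 𝐂)) ∩ᵉ 𝐁) 𝐁 ABC))) ⟩
        rMN Z
            ≡⟨ sym (MN~P-rank (B ∩ C) (set-⊆ (𝐁 ∩ᵉ 𝐂) ((𝐀 ∪ᵉ 𝐁) ∩ᵉ 𝐂) ABC)) ⟩
        rP (B ∩ C) + (u ⊓ v)                 ≡⟨ cong (rP (B ∩ C) +_) (trans u⊓v≡ (+-comm rA∖BC rB∖C)) ⟩
        rP (B ∩ C) + (rB∖C + rA∖BC)          ≡⟨ sym (+-assoc (rP (B ∩ C)) rB∖C rA∖BC) ⟩
        rP (B ∩ C) + rB∖C + rA∖BC            ≡⟨ cong (_+ rA∖BC) (trans (N~P-rank (B ∩ C) (λ x∈ → x∈))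
                                                    (cong rN (set-≡ ((𝐁 ∩ᵉ 𝐂) ∪ᵉ (𝐁 ─ᵉ 𝐂)) 𝐁 ABC))) ⟩
        rN B + rA∖BC                         ∎

    private
      regroup : ∀ a b c d → (a + b) + (c + d) ≡ ((a + c) + d) + b
      regroup = solve-∀
      regroup′ : ∀ a b c d → (a + b) + (c + d) ≡ ((a + c) + b) + d
      regroup′ = solve-∀

    rN[A∩B]+∣B─A∣≤rN[B] : rN (A ∩ B) + ∣ B ─ A ∣ ≤ rN B
    rN[A∩B]+∣B─A∣≤rN[B] = +-cancelʳ-≤ (rA∖B + rA∖BC) _ _ (begin
      (rN (A ∩ B) + ∣ B ─ A ∣) + (rA∖B + rA∖BC)   ≡⟨ regroup (rN (A ∩ B)) _ rA∖B rA∖BC ⟩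
      (rN (A ∩ B) + rA∖B + rA∖BC) + ∣ B ─ A ∣     ≡⟨ cong (λ z → (z + rA∖BC) + ∣ B ─ A ∣) rN[A∩B]+rA∖B≡rM[A] ⟩
      (rM A + rA∖BC) + ∣ B ─ A ∣                   ≤⟨ +-monoˡ-≤ ∣ B ─ A ∣ rM[A]+rA∖BC≤ ⟩
      (rM (A ─ S) + rA∖B) + ∣ B ─ A ∣              ≡⟨ xy∙z≈xz∙y (rM (A ─ S)) rA∖B _ ⟩
      (rM (A ─ S) + ∣ B ─ A ∣) + rA∖B              ≡⟨ cong (_+ rA∖B) rM[A─S]+∣B─A∣≡ ⟩
      (rN B + rA∖BC) + rA∖B                        ≡⟨ xy∙z≈x∙zy (rN B) rA∖BC rA∖B ⟩
      rN B + (rA∖B + rA∖BC)                        ∎)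

    rM[A]+rA∖BC≡ : rM A + rA∖BC ≡ rM (A ─ S) + rA∖B
    rM[A]+rA∖BC≡ = ≤-antisym rM[A]+rA∖BC≤ (+-cancelʳ-≤ ∣ B ─ A ∣ _ _ (begin
      (rM (A ─ S) + rA∖B) + ∣ B ─ A ∣              ≡⟨ xy∙z≈xz∙y (rM (A ─ S)) rA∖B _ ⟩
      (rM (A ─ S) + ∣ B ─ A ∣) + rA∖B              ≡⟨ cong (_+ rA∖B) rM[A─S]+∣B─A∣≡ ⟩
      (rN B + rA∖BC) + rA∖B                        ≤⟨ +-monoˡ-≤ rA∖B (+-monoˡ-≤ rA∖BC rN[B]≤) ⟩
      ((rN (A ∩ B) + ∣ B ─ A ∣) + rA∖BC) + rA∖B    ≡⟨ xy∙z≈x∙zy (rN (A ∩ B) + ∣ B ─ A ∣) rA∖BC rA∖B ⟩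
      (rN (A ∩ B) + ∣ B ─ A ∣) + (rA∖B + rA∖BC)    ≡⟨ regroup (rN (A ∩ B)) _ rA∖B rA∖BC ⟩
      (rN (A ∩ B) + rA∖B + rA∖BC) + ∣ B ─ A ∣      ≡⟨ cong (λ z → (z + rA∖BC) + ∣ B ─ A ∣) rN[A∩B]+rA∖B≡rM[A] ⟩
      (rM A + rA∖BC) + ∣ B ─ A ∣                   ∎))

    B─A⊆isthm : (B ─ A) ⊆ₚ isthm N
    B─A⊆isthm = RN.isthmuses-of-free-extension (set-⊆ 𝐁 ((𝐀 ∩ᵉ 𝐁) ∪ᵉ (𝐁 ─ᵉ 𝐀)) ABC) A∩B⊆B
                  (set-⊆ (𝐁 ─ᵉ 𝐀) 𝐁 ABC) rN[A∩B]+∣B─A∣≤rN[B]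

    rN[Y∩A]+∣Y─A∣≤rN[Y] : ∀ {Y} → Y ⊆ B → rN (Y ∩ A) + ∣ Y ─ A ∣ ≤ rN Y
    rN[Y∩A]+∣Y─A∣≤rN[Y] {Y} Y⊆B = +-cancelʳ-≤ (rN (A ∩ B)) _ _ (begin
      (rN (Y ∩ A) + ∣ Y ─ A ∣) + rN (A ∩ B)   ≡⟨ xy∙z≈x∙zy (rN (Y ∩ A)) _ _ ⟩
      rN (Y ∩ A) + (rN (A ∩ B) + ∣ Y ─ A ∣)   ≤⟨ +-monoʳ-≤ (rN (Y ∩ A)) rN[A∩B]+∣Y─A∣≤ ⟩
      rN (Y ∩ A) + rN (Y ∪ (A ∩ B))           ≡⟨ +-comm (rN (Y ∩ A)) _ ⟩
      rN (Y ∪ (A ∩ B)) + rN (Y ∩ A)           ≡⟨ cong (λ Q → rN (Y ∪ (A ∩ B)) + rN Q) (sym Y∩A∩B≡Y∩A) ⟩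
      rN (Y ∪ (A ∩ B)) + rN (Y ∩ (A ∩ B))     ≤⟨ RN.submod Y⊆B A∩B⊆B ⟩
      rN Y + rN (A ∩ B)                       ∎)
      where
      Y∩B≡Y : Y ∩ B ≡ Y
      Y∩B≡Y = p⊆q⇒p∩q≡p Y⊆B
      Y∩A∩B≡Y∩A : Y ∩ (A ∩ B) ≡ Y ∩ A
      Y∩A∩B≡Y∩A = subst (λ Q → Q ∩ (A ∩ B) ≡ Q ∩ A) Y∩B≡Y (set-≡ ((𝐘 ∩ᵉ 𝐁) ∩ᵉ (𝐀 ∩ᵉ 𝐁)) ((𝐘 ∩ᵉ 𝐁) ∩ᵉ 𝐀) (env ⊥ Y))
      ∣B─A∣≡ : ∣ B ─ A ∣ ≡ ∣ Y ─ A ∣ + ∣ (B ─ A) ─ Y ∣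
      ∣B─A∣≡ = trans (∣p∣≡∣p∩q∣+∣p─q∣ (B ─ A) Y)
        (cong (λ Q → ∣ Q ∣ + ∣ (B ─ A) ─ Y ∣)
              (subst (λ Q → (B ─ A) ∩ Q ≡ Q ─ A) Y∩B≡Y (set-≡ ((𝐁 ─ᵉ 𝐀) ∩ᵉ (𝐘 ∩ᵉ 𝐁)) ((𝐘 ∩ᵉ 𝐁) ─ᵉ 𝐀) (env ⊥ Y))))
      rN[A∩B]+∣Y─A∣≤ : rN (A ∩ B) + ∣ Y ─ A ∣ ≤ rN (Y ∪ (A ∩ B))
      rN[A∩B]+∣Y─A∣≤ = +-cancelʳ-≤ ∣ (B ─ A) ─ Y ∣ _ _ (begin
        (rN (A ∩ B) + ∣ Y ─ A ∣) + ∣ (B ─ A) ─ Y ∣  ≡⟨ +-assoc (rN (A ∩ B)) _ _ ⟩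
        rN (A ∩ B) + (∣ Y ─ A ∣ + ∣ (B ─ A) ─ Y ∣)  ≡⟨ cong (rN (A ∩ B) +_) (sym ∣B─A∣≡) ⟩
        rN (A ∩ B) + ∣ B ─ A ∣                      ≤⟨ rN[A∩B]+∣B─A∣≤rN[B] ⟩
        rN B                                        ≤⟨ RN.rank-≤-cover-free
                                                         (set-⊆ 𝐁 ((𝐘 ∪ᵉ (𝐀 ∩ᵉ 𝐁)) ∪ᵉ ((𝐁 ─ᵉ 𝐀) ─ᵉ 𝐘)) (env ⊥ Y))
                                                         (∪-least Y⊆B A∩B⊆B) (set-⊆ ((𝐁 ─ᵉ 𝐀) ─ᵉ 𝐘) 𝐁 (env ⊥ Y)) ⟩
        rN (Y ∪ (A ∩ B)) + ∣ (B ─ A) ─ Y ∣          ∎)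

    l₁≤l₂ : ∀ X → l₁ X ≤ l₂ X
    l₁≤l₂ X = begin
      rM (X ∩ A) + ∣ X ─ A ∣
          ≤⟨ +-monoˡ-≤ ∣ X ─ A ∣ (RM.mono (set-⊆ (𝐗 ∩ᵉ 𝐀) (((𝐗 ∩ᵉ 𝐁) ∩ᵉ 𝐀) ∪ᵉ (𝐀 ─ᵉ 𝐁)) (env X ⊥))
                                          (set-⊆ (((𝐗 ∩ᵉ 𝐁) ∩ᵉ 𝐀) ∪ᵉ (𝐀 ─ᵉ 𝐁)) 𝐀 (env X ⊥))) ⟩
      rM (((X ∩ B) ∩ A) ∪ (A ─ B)) + ∣ X ─ A ∣
          ≡⟨ cong₂ _+_ (sym (M~N-rank ((X ∩ B) ∩ A) (set-⊆ ((𝐗 ∩ᵉ 𝐁) ∩ᵉ 𝐀) (𝐀 ∩ᵉ 𝐁) (env X ⊥)))) (∣X─A∣≡ X) ⟩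
      (rN ((X ∩ B) ∩ A) + rA∖B) + (∣ (X ∩ B) ─ A ∣ + ∣ X ─ (A ∪ B) ∣)
          ≡⟨ regroup′ (rN ((X ∩ B) ∩ A)) rA∖B _ _ ⟩
      ((rN ((X ∩ B) ∩ A) + ∣ (X ∩ B) ─ A ∣) + rA∖B) + ∣ X ─ (A ∪ B) ∣
          ≤⟨ +-monoˡ-≤ ∣ X ─ (A ∪ B) ∣ (+-monoˡ-≤ rA∖B (rN[Y∩A]+∣Y─A∣≤rN[Y] (set-⊆ (𝐗 ∩ᵉ 𝐁) 𝐁 (env X ⊥)))) ⟩
      (rN (X ∩ B) + rA∖B) + ∣ X ─ (A ∪ B) ∣
          ≡⟨ sym (l₂≡′ X) ⟩
      l₂ X ∎

    l₁≤r₂ : ∀ X → X ⊆ E → l₁ X ≤ r₂ X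
    l₁≤r₂ X X⊆E = begin
      rM (X ∩ A) + ∣ X ─ A ∣
          ≤⟨ +-monoˡ-≤ ∣ X ─ A ∣ (RM.rank-≤-cover-free
               (set-⊆ (𝐗 ∩ᵉ 𝐀) ((((𝐗 ∩ᵉ 𝐁) ∩ᵉ 𝐀) ∪ᵉ (𝐀 ─ᵉ (𝐁 ∪ᵉ 𝐂))) ∪ᵉ (𝐗 ∩ᵉ ((𝐀 ∩ᵉ 𝐂) ─ᵉ 𝐁))) (env X ⊥))
                                   V⊆A (set-⊆ (𝐗 ∩ᵉ ((𝐀 ∩ᵉ 𝐂) ─ᵉ 𝐁)) 𝐀 (env X ⊥))) ⟩
      (rM V + ∣ X ∩ S ∣) + ∣ X ─ A ∣
          ≡⟨ +-assoc (rM V) _ _ ⟩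
      rM V + (∣ X ∩ S ∣ + ∣ X ─ A ∣)
          ≡⟨ cong (rM V +_) ∣X∩S∣+∣X─A∣≡ ⟩
      rM V + (∣ (X ∩ B) ─ A ∣ + ∣ (X ∩ (B ∪ C)) ─ B ∣)
          ≤⟨ +-monoˡ-≤ _ rM[V]≤ ⟩
      (rN ((X ∩ B) ∩ A) + rA∖BC) + (∣ (X ∩ B) ─ A ∣ + ∣ (X ∩ (B ∪ C)) ─ B ∣)
          ≡⟨ regroup (rN ((X ∩ B) ∩ A)) rA∖BC _ _ ⟩
      ((rN ((X ∩ B) ∩ A) + ∣ (X ∩ B) ─ A ∣) + ∣ (X ∩ (B ∪ C)) ─ B ∣) + rA∖BC
          ≤⟨ +-monoˡ-≤ rA∖BC (+-monoˡ-≤ _ (rN[Y∩A]+∣Y─A∣≤rN[Y] (set-⊆ (𝐗 ∩ᵉ 𝐁) 𝐁 (env X ⊥)))) ⟩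
      (rN (X ∩ B) + ∣ (X ∩ (B ∪ C)) ─ B ∣) + rA∖BC
          ≡⟨ sym (r₂≡ X) ⟩
      r₂ X ∎
      where
      V : Subset n
      V = ((X ∩ B) ∩ A) ∪ (A ─ (B ∪ C))
      V⊆A : V ⊆ A
      V⊆A = set-⊆ (((𝐗 ∩ᵉ 𝐁) ∩ᵉ 𝐀) ∪ᵉ (𝐀 ─ᵉ (𝐁 ∪ᵉ 𝐂))) 𝐀 (env X ⊥)
      rM[V∪S]≡ : rM (V ∪ S) ≡ rN ((X ∩ B) ∩ A) + rA∖B
      rM[V∪S]≡ = trans (cong rM (set-≡ ((((𝐗 ∩ᵉ 𝐁) ∩ᵉ 𝐀) ∪ᵉ (𝐀 ─ᵉ (𝐁 ∪ᵉ 𝐂))) ∪ᵉ ((𝐀 ∩ᵉ 𝐂) ─ᵉ 𝐁))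
                                          (((𝐗 ∩ᵉ 𝐁) ∩ᵉ 𝐀) ∪ᵉ (𝐀 ─ᵉ 𝐁)) (env X ⊥)))
                       (sym (M~N-rank ((X ∩ B) ∩ A) (set-⊆ ((𝐗 ∩ᵉ 𝐁) ∩ᵉ 𝐀) (𝐀 ∩ᵉ 𝐁) (env X ⊥))))
      submodular : rM A + rM V ≤ rM (V ∪ S) + rM (A ─ S)
      submodular = subst₂ (λ U W → rM U + rM W ≤ rM (V ∪ S) + rM (A ─ S))
        (set-≡ (((((𝐗 ∩ᵉ 𝐁) ∩ᵉ 𝐀) ∪ᵉ (𝐀 ─ᵉ (𝐁 ∪ᵉ 𝐂))) ∪ᵉ ((𝐀 ∩ᵉ 𝐂) ─ᵉ 𝐁)) ∪ᵉ (𝐀 ─ᵉ ((𝐀 ∩ᵉ 𝐂) ─ᵉ 𝐁))) 𝐀 (env X ⊥))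
        (set-≡ (((((𝐗 ∩ᵉ 𝐁) ∩ᵉ 𝐀) ∪ᵉ (𝐀 ─ᵉ (𝐁 ∪ᵉ 𝐂))) ∪ᵉ ((𝐀 ∩ᵉ 𝐂) ─ᵉ 𝐁)) ∩ᵉ (𝐀 ─ᵉ ((𝐀 ∩ᵉ 𝐂) ─ᵉ 𝐁)))
               (((𝐗 ∩ᵉ 𝐁) ∩ᵉ 𝐀) ∪ᵉ (𝐀 ─ᵉ (𝐁 ∪ᵉ 𝐂))) (env X ⊥))
        (RM.submod (∪-least V⊆A S⊆A) A─S⊆A)
      rM[V]≤ : rM V ≤ rN ((X ∩ B) ∩ A) + rA∖BC
      rM[V]≤ = +-cancelʳ-≤ (rM (A ─ S) + rA∖B) _ _ (begin
        rM V + (rM (A ─ S) + rA∖B)                   ≡⟨ cong (rM V +_) (sym rM[A]+rA∖BC≡) ⟩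
        rM V + (rM A + rA∖BC)                        ≡⟨ x∙yz≈y∙xz (rM V) (rM A) rA∖BC ⟩
        rM A + (rM V + rA∖BC)                        ≡⟨ sym (+-assoc (rM A) (rM V) rA∖BC) ⟩
        (rM A + rM V) + rA∖BC                        ≤⟨ +-monoˡ-≤ rA∖BC submodular ⟩
        (rM (V ∪ S) + rM (A ─ S)) + rA∖BC            ≡⟨ cong (λ z → (z + rM (A ─ S)) + rA∖BC) rM[V∪S]≡ ⟩
        ((rN ((X ∩ B) ∩ A) + rA∖B) + rM (A ─ S)) + rA∖BC
                                                     ≡⟨ shuffle (rN ((X ∩ B) ∩ A)) rA∖B (rM (A ─ S)) rA∖BC ⟩
        (rN ((X ∩ B) ∩ A) + rA∖BC) + (rM (A ─ S) + rA∖B) ∎)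
        where
        shuffle : ∀ a b c d → ((a + b) + c) + d ≡ (a + d) + (c + b)
        shuffle = solve-∀
      ∣X∩S∣+∣X─A∣≡ : ∣ X ∩ S ∣ + ∣ X ─ A ∣ ≡ ∣ (X ∩ B) ─ A ∣ + ∣ (X ∩ (B ∪ C)) ─ B ∣
      ∣X∩S∣+∣X─A∣≡ = begin-equality
        ∣ X ∩ S ∣ + ∣ X ─ A ∣                                      ≡⟨ cong (∣ X ∩ S ∣ +_)
            (trans (∣X─A∣≡ X) (cong (∣ (X ∩ B) ─ A ∣ +_) outside-AB)) ⟩
        ∣ X ∩ S ∣ + (∣ (X ∩ B) ─ A ∣ + ∣ (X ∩ C) ─ (A ∪ B) ∣)      ≡⟨ x∙yz≈y∙xz ∣ X ∩ S ∣ ∣ (X ∩ B) ─ A ∣ _ ⟩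
        ∣ (X ∩ B) ─ A ∣ + (∣ X ∩ S ∣ + ∣ (X ∩ C) ─ (A ∪ B) ∣)      ≡⟨ cong (∣ (X ∩ B) ─ A ∣ +_) (sym ∣X∩BC─B∣≡) ⟩
        ∣ (X ∩ B) ─ A ∣ + ∣ (X ∩ (B ∪ C)) ─ B ∣                    ∎
        where
        outside-AB : ∣ X ─ (A ∪ B) ∣ ≡ ∣ (X ∩ C) ─ (A ∪ B) ∣
        outside-AB = cong ∣_∣ (subst (λ Q → Q ─ (A ∪ B) ≡ (Q ∩ C) ─ (A ∪ B)) (p⊆q⇒p∩q≡p X⊆E)
          (set-≡ ((𝐗 ∩ᵉ ((𝐀 ∪ᵉ 𝐁) ∪ᵉ 𝐂)) ─ᵉ (𝐀 ∪ᵉ 𝐁)) (((𝐗 ∩ᵉ ((𝐀 ∪ᵉ 𝐁) ∪ᵉ 𝐂)) ∩ᵉ 𝐂) ─ᵉ (𝐀 ∪ᵉ 𝐁)) (env X ⊥)))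
        ∣X∩BC─B∣≡ : ∣ (X ∩ (B ∪ C)) ─ B ∣ ≡ ∣ X ∩ S ∣ + ∣ (X ∩ C) ─ (A ∪ B) ∣
        ∣X∩BC─B∣≡ = trans (∣p∣≡∣p∩q∣+∣p─q∣ ((X ∩ (B ∪ C)) ─ B) A)
          (cong₂ (λ U W → ∣ U ∣ + ∣ W ∣) (set-≡ (((𝐗 ∩ᵉ (𝐁 ∪ᵉ 𝐂)) ─ᵉ 𝐁) ∩ᵉ 𝐀) (𝐗 ∩ᵉ ((𝐀 ∩ᵉ 𝐂) ─ᵉ 𝐁)) (env X ⊥))
                                        (set-≡ (((𝐗 ∩ᵉ (𝐁 ∪ᵉ 𝐂)) ─ᵉ 𝐁) ─ᵉ 𝐀) ((𝐗 ∩ᵉ 𝐂) ─ᵉ (𝐀 ∪ᵉ 𝐁)) (env X ⊥)))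

    tight⇒L≅R : L ≅ R
    tight⇒L≅R = L≅R-from-terms λ X X⊆E →
      ⊓-agree-when-l₃≡r₃ (l₁ X) (l₂ X) (l₃ X) (l₄ X) (r₂ X) (r₃ X) (l₃≡r₃ X) (r₃≤l₄ X) (l₁≤l₂ X) (l₁≤r₂ X X⊆E)
      where
      l₃≡r₃ : ∀ X → l₃ X ≡ r₃ X
      l₃≡r₃ X = trans (cong (rP (X ∩ C) +_) (trans u-tight (+-comm rA∖BC rB∖C))) (sym (r₃≡ X))

    S⊆isthm : rA∖BC + ∣ S ∣ ≤ rA∖B → S ⊆ₚ isthm M
    S⊆isthm rA∖BC+∣S∣≤rA∖B = RM.isthmuses-of-free-extension
      (set-⊆ 𝐀 ((𝐀 ─ᵉ ((𝐀 ∩ᵉ 𝐂) ─ᵉ 𝐁)) ∪ᵉ ((𝐀 ∩ᵉ 𝐂) ─ᵉ 𝐁)) ABC) A─S⊆A S⊆A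
      (+-cancelʳ-≤ rA∖BC _ _ (begin
        (rM (A ─ S) + ∣ S ∣) + rA∖BC    ≡⟨ xy∙z≈x∙zy (rM (A ─ S)) ∣ S ∣ rA∖BC ⟩
        rM (A ─ S) + (rA∖BC + ∣ S ∣)    ≤⟨ +-monoʳ-≤ (rM (A ─ S)) rA∖BC+∣S∣≤rA∖B ⟩
        rM (A ─ S) + rA∖B               ≡⟨ sym rM[A]+rA∖BC≡ ⟩
        rM A + rA∖BC                    ∎))

    module Dependent (rA∖B<rA∖BC+∣S∣ : rA∖B < rA∖BC + ∣ S ∣) where
      rA∖B≡′ : rA∖B ≡ rA∖BC + (rP S + rB∖C)
      rA∖B≡′ = trans rA∖B≡ (cong (rA∖BC +_) (sym (⊓-attained-right refl
                 (+-cancelˡ-< rA∖BC _ _ (≤-<-trans (≤-reflexive (sym rA∖B≡)) rA∖B<rA∖BC+∣S∣)))))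
      rP[S]+rA∖BC+rB∖C≡ : rP S + (rA∖BC + rB∖C) ≡ rB∖C + rA∖B
      rP[S]+rA∖BC+rB∖C≡ = trans (cong (rP S +_) (sym u⊓v≡)) rP[S]+u⊓v≡
      rB∖C≡0 : rB∖C ≡ 0
      rB∖C≡0 = sym (+-cancelˡ-≡ (rP S + (rA∖BC + rB∖C)) 0 rB∖C (begin-equality
        (rP S + (rA∖BC + rB∖C)) + 0           ≡⟨ +-identityʳ _ ⟩
        rP S + (rA∖BC + rB∖C)                 ≡⟨ rP[S]+rA∖BC+rB∖C≡ ⟩
        rB∖C + rA∖B                           ≡⟨ cong (rB∖C +_) rA∖B≡′ ⟩
        rB∖C + (rA∖BC + (rP S + rB∖C))        ≡⟨ rotate rB∖C rA∖BC (rP S) ⟩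
        (rP S + (rA∖BC + rB∖C)) + rB∖C        ∎))
        where
        rotate : ∀ q d p → q + (d + (p + q)) ≡ (p + (d + q)) + q
        rotate = solve-∀
      B─C⊆loops : (B ─ C) ⊆ₚ loops N
      B─C⊆loops e∈ = RN.loop-of-rank-0 rB∖C≡0 B─C⊆B e∈
      rP[S]+rA∖BC≡rA∖B : rP S + rA∖BC ≡ rA∖B
      rP[S]+rA∖BC≡rA∖B = +-cancelˡ-≡ rB∖C _ _ (trans (x∙yz≈y∙xz rB∖C (rP S) rA∖BC)
                           (trans (cong (rP S +_) (+-comm rB∖C rA∖BC)) rP[S]+rA∖BC+rB∖C≡))
      B⊆A∪C : B ⊆ A ∪ C
      B⊆A∪C {e} e∈B with e ∈? A | e ∈? C
      ... | yes e∈A | _       = x∈p∪q⁺ (inj₁ e∈A)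
      ... | no _    | yes e∈C = x∈p∪q⁺ (inj₂ e∈C)
      ... | no e∉A  | no e∉C  = ⊥-elim (RN.loop⇒¬isthmus (B─C⊆loops (x∈p∧x∉q⇒x∈p─q e∈B e∉C))
                                                          (B─A⊆isthm (x∈p∧x∉q⇒x∈p─q e∈B e∉A)))
      Y : Subset n
      Y = T ∪ (B ─ C)
      Y⊆B : Y ⊆ B
      Y⊆B = set-⊆ ((𝐀 ∩ᵉ (𝐁 ∩ᵉ 𝐂)) ∪ᵉ (𝐁 ─ᵉ 𝐂)) 𝐁 ABC
      Y∩A≡A∩B : Y ∩ A ≡ A ∩ B
      Y∩A≡A∩B = set-≡ (((𝐀 ∩ᵉ (𝐁 ∩ᵉ 𝐂)) ∪ᵉ (𝐁 ─ᵉ 𝐂)) ∩ᵉ 𝐀) (𝐀 ∩ᵉ 𝐁) ABC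
      rN[Y]≡ : rN Y ≡ rN (A ∩ B) + ∣ Y ─ A ∣
      rN[Y]≡ = ≤-antisym
        (subst (λ Q → rN Y ≤ rN Q + ∣ Y ─ A ∣) Y∩A≡A∩B
          (RN.rank-≤-cover-free (set-⊆ 𝐘 ((𝐘 ∩ᵉ 𝐀) ∪ᵉ (𝐘 ─ᵉ 𝐀)) (env ⊥ Y))
             (λ x∈ → Y⊆B (set-⊆ (𝐘 ∩ᵉ 𝐀) 𝐘 (env ⊥ Y) x∈)) (λ x∈ → Y⊆B (set-⊆ (𝐘 ─ᵉ 𝐀) 𝐘 (env ⊥ Y) x∈))))
        (subst (λ Q → rN Q + ∣ Y ─ A ∣ ≤ rN Y) Y∩A≡A∩B (rN[Y∩A]+∣Y─A∣≤rN[Y] Y⊆B))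
      rP[T]≡ : rP T ≡ rN (A ∩ B) + ∣ Y ─ A ∣
      rP[T]≡ = begin-equality
        rP T            ≡⟨ sym (+-identityʳ (rP T)) ⟩
        rP T + 0        ≡⟨ cong (rP T +_) (sym rB∖C≡0) ⟩
        rP T + rB∖C     ≡⟨ N~P-rank T (set-⊆ (𝐀 ∩ᵉ (𝐁 ∩ᵉ 𝐂)) (𝐁 ∩ᵉ 𝐂) ABC) ⟩
        rN Y            ≡⟨ rN[Y]≡ ⟩
        rN (A ∩ B) + ∣ Y ─ A ∣ ∎
      Z : Subset n
      Z = (S ∪ T) ∪ ((A ∪ B) ─ C)
      rMN[Z]≡ : rMN Z ≡ rM A + ∣ Y ─ A ∣
      rMN[Z]≡ = trans (cong₂ _⊓_ via-M via-N) (⊓-idem _)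
        where
        via-M : rM (Z ∩ A) + ∣ Z ─ A ∣ ≡ rM A + ∣ Y ─ A ∣
        via-M = cong₂ (λ U W → rM U + ∣ W ∣)
          (set-≡ (((((𝐀 ∩ᵉ 𝐂) ─ᵉ 𝐁) ∪ᵉ (𝐀 ∩ᵉ (𝐁 ∩ᵉ 𝐂))) ∪ᵉ ((𝐀 ∪ᵉ 𝐁) ─ᵉ 𝐂)) ∩ᵉ 𝐀) 𝐀 ABC)
          (set-≡ (((((𝐀 ∩ᵉ 𝐂) ─ᵉ 𝐁) ∪ᵉ (𝐀 ∩ᵉ (𝐁 ∩ᵉ 𝐂))) ∪ᵉ ((𝐀 ∪ᵉ 𝐁) ─ᵉ 𝐂)) ─ᵉ 𝐀)
                 (((𝐀 ∩ᵉ (𝐁 ∩ᵉ 𝐂)) ∪ᵉ (𝐁 ─ᵉ 𝐂)) ─ᵉ 𝐀) ABC)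
        via-N : rN (Z ∩ B) + rA∖B ≡ rM A + ∣ Y ─ A ∣
        via-N = begin-equality
          rN (Z ∩ B) + rA∖B                   ≡⟨ cong (λ U → rN U + rA∖B)
              (set-≡ (((((𝐀 ∩ᵉ 𝐂) ─ᵉ 𝐁) ∪ᵉ (𝐀 ∩ᵉ (𝐁 ∩ᵉ 𝐂))) ∪ᵉ ((𝐀 ∪ᵉ 𝐁) ─ᵉ 𝐂)) ∩ᵉ 𝐁)
                     ((𝐀 ∩ᵉ (𝐁 ∩ᵉ 𝐂)) ∪ᵉ (𝐁 ─ᵉ 𝐂)) ABC) ⟩
          rN Y + rA∖B                         ≡⟨ cong (_+ rA∖B) rN[Y]≡ ⟩
          (rN (A ∩ B) + ∣ Y ─ A ∣) + rA∖B     ≡⟨ xy∙z≈xz∙y (rN (A ∩ B)) _ rA∖B ⟩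
          (rN (A ∩ B) + rA∖B) + ∣ Y ─ A ∣     ≡⟨ cong (_+ ∣ Y ─ A ∣) rN[A∩B]+rA∖B≡rM[A] ⟩
          rM A + ∣ Y ─ A ∣                    ∎
      rP[S∪T]+rA∖BC≡ : rP (S ∪ T) + rA∖BC ≡ rM A + ∣ Y ─ A ∣
      rP[S∪T]+rA∖BC≡ = begin-equality
        rP (S ∪ T) + rA∖BC             ≡⟨ cong (rP (S ∪ T) +_)
            (sym (trans (trans u⊓v≡ (cong (rA∖BC +_) rB∖C≡0)) (+-identityʳ rA∖BC))) ⟩
        rP (S ∪ T) + (u ⊓ v)           ≡⟨ MN~P-rank (S ∪ T)
            (set-⊆ (((𝐀 ∩ᵉ 𝐂) ─ᵉ 𝐁) ∪ᵉ (𝐀 ∩ᵉ (𝐁 ∩ᵉ 𝐂))) ((𝐀 ∪ᵉ 𝐁) ∩ᵉ 𝐂) ABC) ⟩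
        rMN Z                          ≡⟨ rMN[Z]≡ ⟩
        rM A + ∣ Y ─ A ∣               ∎
      modular : rP S + rP T ≡ rP (S ∪ T) + rP (S ∩ T)
      modular = begin-equality
        rP S + rP T                    ≡⟨ +-cancelʳ-≡ rA∖BC _ _ (begin-equality
            (rP S + rP T) + rA∖BC            ≡⟨ xy∙z≈xz∙y (rP S) (rP T) rA∖BC ⟩
            (rP S + rA∖BC) + rP T            ≡⟨ cong₂ _+_ rP[S]+rA∖BC≡rA∖B rP[T]≡ ⟩
            rA∖B + (rN (A ∩ B) + ∣ Y ─ A ∣)  ≡⟨ x∙yz≈yx∙z rA∖B (rN (A ∩ B)) _ ⟩
            (rN (A ∩ B) + rA∖B) + ∣ Y ─ A ∣  ≡⟨ cong (_+ ∣ Y ─ A ∣) rN[A∩B]+rA∖B≡rM[A] ⟩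
            rM A + ∣ Y ─ A ∣                 ≡⟨ sym rP[S∪T]+rA∖BC≡ ⟩
            rP (S ∪ T) + rA∖BC               ∎) ⟩
        rP (S ∪ T)                     ≡⟨ sym (+-identityʳ _) ⟩
        rP (S ∪ T) + 0                 ≡⟨ cong (rP (S ∪ T) +_) (sym (trans (cong rP S∩T≡∅) RP.rank-⊥)) ⟩
        rP (S ∪ T) + rP (S ∩ T)        ∎
        where
        S∩T≡∅ : S ∩ T ≡ ⊥
        S∩T≡∅ = set-≡ (((𝐀 ∩ᵉ 𝐂) ─ᵉ 𝐁) ∩ᵉ (𝐀 ∩ᵉ (𝐁 ∩ᵉ 𝐂))) ∅ᵉ ABC

      modular-case : B ⊆ A ∪ C × ((B ─ A) ⊆ₚ isthm N × (B ─ C) ⊆ₚ loops N) × ModularPair P S T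
      modular-case = B⊆A∪C , (B─A⊆isthm , B─C⊆loops) , modular

    tight⇒condition : Condition
    tight⇒condition with rA∖BC + ∣ S ∣ ≤? rA∖B
    ... | yes S-free      = inj₂ (inj₁ (S⊆isthm S-free , B─A⊆isthm))
    ... | no S-dependent  = inj₂ (inj₂ (inj₂ (Dependent.modular-case (≰⇒> S-dependent))))

  loose⇒¬L≅R : rA∖BC + rB∖C < u → rA∖BC < rA∖B → ¬ (L ≅ R)
  loose⇒¬L≅R u-loose rA∖BC<rA∖B (_ , L≡R) = <-irrefl (sym (L≡R E (λ x∈ → x∈))) (begin-strict
      rank R E                          ≤⟨ ≤-trans (≤-reflexive (rank-R≡ E))
                                               (≤-trans (m⊓n≤n (l₁ E) _) (m⊓n≤n (r₂ E) _)) ⟩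
      r₃ E                              ≡⟨ r₃≡ E ⟩
      rP (E ∩ C) + (rB∖C + rA∖BC)       <⟨ ⊓-glb via-MN via-P ⟩
      rank L E                          ∎)
    where
    open ≤-Reasoning
    W : Subset n
    W = C ∩ (A ∪ B)
    u⊓v> : rB∖C + rA∖BC < u ⊓ v
    u⊓v> = subst (_< u ⊓ v) (+-comm rA∖BC rB∖C) (⊓-glb u-loose (rA∖BC+rB∖C<v rA∖BC<rA∖B))
    via-P : rP (E ∩ C) + (rB∖C + rA∖BC) < rP (E ∩ C) + (u ⊓ v)
    via-P = +-monoʳ-< (rP (E ∩ C)) u⊓v>
    via-MN : rP (E ∩ C) + (rB∖C + rA∖BC) < rMN (E ∩ (A ∪ B)) + ∣ E ─ (A ∪ B) ∣
    via-MN = begin-strict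
      rP (E ∩ C) + (rB∖C + rA∖BC)              <⟨ via-P ⟩
      rP (E ∩ C) + (u ⊓ v)                     ≤⟨ +-monoˡ-≤ (u ⊓ v) (RP.rank-≤-cover-free
          (set-⊆ (((𝐀 ∪ᵉ 𝐁) ∪ᵉ 𝐂) ∩ᵉ 𝐂) ((𝐂 ∩ᵉ (𝐀 ∪ᵉ 𝐁)) ∪ᵉ (((𝐀 ∪ᵉ 𝐁) ∪ᵉ 𝐂) ─ᵉ (𝐀 ∪ᵉ 𝐁))) ABC)
          (set-⊆ (𝐂 ∩ᵉ (𝐀 ∪ᵉ 𝐁)) 𝐂 ABC) (set-⊆ (((𝐀 ∪ᵉ 𝐁) ∪ᵉ 𝐂) ─ᵉ (𝐀 ∪ᵉ 𝐁)) 𝐂 ABC)) ⟩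
      (rP W + ∣ E ─ (A ∪ B) ∣) + (u ⊓ v)       ≡⟨ xy∙z≈xz∙y (rP W) _ (u ⊓ v) ⟩
      (rP W + (u ⊓ v)) + ∣ E ─ (A ∪ B) ∣       ≡⟨ cong (_+ ∣ E ─ (A ∪ B) ∣) (trans
          (MN~P-rank W (set-⊆ (𝐂 ∩ᵉ (𝐀 ∪ᵉ 𝐁)) ((𝐀 ∪ᵉ 𝐁) ∩ᵉ 𝐂) ABC))
          (cong rMN (set-≡ ((𝐂 ∩ᵉ (𝐀 ∪ᵉ 𝐁)) ∪ᵉ ((𝐀 ∪ᵉ 𝐁) ─ᵉ 𝐂)) (((𝐀 ∪ᵉ 𝐁) ∪ᵉ 𝐂) ∩ᵉ (𝐀 ∪ᵉ 𝐁)) ABC))) ⟩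
      rMN (E ∩ (A ∪ B)) + ∣ E ─ (A ∪ B) ∣      ∎

  collapsed⇒loops : rA∖B ≤ rA∖BC → Nonempty S → S ⊆ₚ loops P × (B ─ C) ⊆ₚ loops N
  collapsed⇒loops rA∖B≤rA∖BC (x , x∈S) =
    (λ e∈ → RP.loop-of-rank-0 (m+n≡0⇒m≡0 (rP S) sum≡0) S⊆C e∈) ,
    (λ e∈ → RN.loop-of-rank-0 (m+n≡0⇒n≡0 (rP S) sum≡0) B─C⊆B e∈)
    where
    open ≤-Reasoning
    min≡0 : ∣ S ∣ ⊓ (rP S + rB∖C) ≡ 0
    min≡0 = n≤0⇒n≡0 (+-cancelˡ-≤ rA∖BC _ _ (begin
      rA∖BC + (∣ S ∣ ⊓ (rP S + rB∖C))  ≡⟨ sym rA∖B≡ ⟩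
      rA∖B                             ≤⟨ rA∖B≤rA∖BC ⟩
      rA∖BC                            ≡⟨ sym (+-identityʳ rA∖BC) ⟩
      rA∖BC + 0                        ∎))
    sum≡0 : rP S + rB∖C ≡ 0
    sum≡0 = ⊓-attained-right min≡0 (x∈p⇒0<∣p∣ x∈S)

  isthmuses⇒rA∖BC+∣S∣≤rA∖B : S ⊆ₚ isthm M → rA∖BC + ∣ S ∣ ≤ rA∖B
  isthmuses⇒rA∖BC+∣S∣≤rA∖B S⊆isthm = subst₂ (λ U W → rM U + ∣ W ∣ ≤ rA∖B)
    (set-≡ ((𝐀 ─ᵉ 𝐁) ─ᵉ ((𝐀 ∩ᵉ 𝐂) ─ᵉ 𝐁)) (𝐀 ─ᵉ (𝐁 ∪ᵉ 𝐂)) ABC)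
    (set-≡ ((𝐀 ─ᵉ 𝐁) ∩ᵉ ((𝐀 ∩ᵉ 𝐂) ─ᵉ 𝐁)) ((𝐀 ∩ᵉ 𝐂) ─ᵉ 𝐁) ABC)
    (RM.rank-─-isthmuses S⊆isthm (A ─ B) A─B⊆A)

  isthmuses⇒u≤ : S ⊆ₚ isthm M → (B ─ A) ⊆ₚ isthm N → u ≤ rA∖BC + rB∖C
  isthmuses⇒u≤ S⊆isthm B─A⊆isthm = begin
      u                                       ≡⟨ u≡ ⟩
      rM (A ─ C) + ∣ B∖AC ∣                   ≤⟨ +-monoˡ-≤ ∣ B∖AC ∣ rM[A─C]≤ ⟩
      (rN AB∖C + rA∖BC) + ∣ B∖AC ∣            ≡⟨ xy∙z≈xz∙y (rN AB∖C) rA∖BC _ ⟩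
      (rN AB∖C + ∣ B∖AC ∣) + rA∖BC            ≤⟨ +-monoˡ-≤ rA∖BC rN[AB∖C]+∣B∖AC∣≤ ⟩
      rB∖C + rA∖BC                            ≡⟨ +-comm rB∖C rA∖BC ⟩
      rA∖BC + rB∖C                            ∎
    where
    open ≤-Reasoning
    rM[A─C]+∣S∣≤ : rM (A ─ C) + ∣ S ∣ ≤ rN AB∖C + rA∖B
    rM[A─C]+∣S∣≤ = subst₂ (λ U W → rM U + ∣ W ∣ ≤ rN AB∖C + rA∖B)
      (set-≡ ((((𝐁 ─ᵉ 𝐂) ∩ᵉ 𝐀) ∪ᵉ (𝐀 ─ᵉ 𝐁)) ─ᵉ ((𝐀 ∩ᵉ 𝐂) ─ᵉ 𝐁)) (𝐀 ─ᵉ 𝐂) ABC)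
      (set-≡ ((((𝐁 ─ᵉ 𝐂) ∩ᵉ 𝐀) ∪ᵉ (𝐀 ─ᵉ 𝐁)) ∩ᵉ ((𝐀 ∩ᵉ 𝐂) ─ᵉ 𝐁)) ((𝐀 ∩ᵉ 𝐂) ─ᵉ 𝐁) ABC)
      (≤-trans (RM.rank-─-isthmuses S⊆isthm (AB∖C ∪ (A ─ B)) (set-⊆ (((𝐁 ─ᵉ 𝐂) ∩ᵉ 𝐀) ∪ᵉ (𝐀 ─ᵉ 𝐁)) 𝐀 ABC))
               (≤-reflexive (sym rN[AB∖C]+rA∖B≡)))
    rM[A─C]≤ : rM (A ─ C) ≤ rN AB∖C + rA∖BC
    rM[A─C]≤ = +-cancelʳ-≤ ∣ S ∣ _ _ (begin
      rM (A ─ C) + ∣ S ∣               ≤⟨ rM[A─C]+∣S∣≤ ⟩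
      rN AB∖C + rA∖B                   ≤⟨ +-monoʳ-≤ (rN AB∖C) rA∖B≤rA∖BC+∣S∣ ⟩
      rN AB∖C + (rA∖BC + ∣ S ∣)        ≡⟨ sym (+-assoc (rN AB∖C) rA∖BC ∣ S ∣) ⟩
      rN AB∖C + rA∖BC + ∣ S ∣          ∎)
    rN[AB∖C]+∣B∖AC∣≤ : rN AB∖C + ∣ B∖AC ∣ ≤ rB∖C
    rN[AB∖C]+∣B∖AC∣≤ = subst₂ (λ U W → rN U + ∣ W ∣ ≤ rB∖C)
      (set-≡ ((𝐁 ─ᵉ 𝐂) ─ᵉ (𝐁 ─ᵉ 𝐀)) ((𝐁 ─ᵉ 𝐂) ∩ᵉ 𝐀) ABC)
      (set-≡ ((𝐁 ─ᵉ 𝐂) ∩ᵉ (𝐁 ─ᵉ 𝐀)) (𝐁 ─ᵉ (𝐀 ∪ᵉ 𝐂)) ABC)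
      (RN.rank-─-isthmuses B─A⊆isthm (B ─ C) B─C⊆B)

  necessity : L ≅ R → Condition
  necessity L≅R with nonempty? S
  ... | no S-empty = inj₁ S-empty
  ... | yes S-nonempty with rA∖B ≤? rA∖BC
  ...   | yes rA∖B≤rA∖BC = inj₂ (inj₂ (inj₁ (collapsed⇒loops rA∖B≤rA∖BC S-nonempty)))
  ...   | no rA∖B≰rA∖BC with u ≤? rA∖BC + rB∖C
  ...     | no u≰ = ⊥-elim (loose⇒¬L≅R (≰⇒> u≰) (≰⇒> rA∖B≰rA∖BC) L≅R)
  ...     | yes u≤ = Tight.tight⇒condition u≤ (≰⇒> rA∖B≰rA∖BC)

  loops⇒u≤ : (B ─ C) ⊆ₚ loops N → rA∖BC < rA∖B → u ≤ rA∖BC + rB∖C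
  loops⇒u≤ B─C⊆loops rA∖BC<rA∖B =
    ⊓-bounded-left (≤-reflexive u⊓v≡) (rA∖BC+rB∖C<v rA∖BC<rA∖B)
    where
    rB∖C≡0 : rB∖C ≡ 0
    rB∖C≡0 = RN.loops-rank-0 B─C⊆loops B─C⊆B
    rA∖B≡′ : rA∖B ≡ rA∖BC + (rP S + rB∖C)
    rA∖B≡′ = trans rA∖B≡ (cong (rA∖BC +_) (m≥n⇒m⊓n≡n
               (≤-trans (≤-reflexive (trans (cong (rP S +_) rB∖C≡0) (+-identityʳ (rP S))))
                        (RP.rank-≤-card S S⊆C))))
    u⊓v≡ : u ⊓ v ≡ rA∖BC + rB∖C
    u⊓v≡ = +-cancelˡ-≡ (rP S) _ _ (begin-equality
      rP S + (u ⊓ v)                      ≡⟨ rP[S]+u⊓v≡ ⟩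
      rB∖C + rA∖B                         ≡⟨ cong (rB∖C +_) rA∖B≡′ ⟩
      rB∖C + (rA∖BC + (rP S + rB∖C))      ≡⟨ cong (λ q → q + (rA∖BC + (rP S + q))) rB∖C≡0 ⟩
      0 + (rA∖BC + (rP S + 0))            ≡⟨ drop-zeros (rP S) rA∖BC ⟩
      rP S + (rA∖BC + 0)                  ≡⟨ cong (λ q → rP S + (rA∖BC + q)) (sym rB∖C≡0) ⟩
      rP S + (rA∖BC + rB∖C)               ∎)
      where
      open ≤-Reasoning
      drop-zeros : ∀ p d → 0 + (d + (p + 0)) ≡ p + (d + 0)
      drop-zeros = solve-∀

  sufficiency : Condition → L ≅ R
  sufficiency (inj₁ S-empty) = S≡∅⇒L≅R (Empty-unique S-empty)
  sufficiency (inj₂ (inj₁ (S⊆isthm , B─A⊆isthm))) with nonempty? S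
  ... | no S-empty = S≡∅⇒L≅R (Empty-unique S-empty)
  ... | yes (x , x∈S) = Tight.tight⇒L≅R (isthmuses⇒u≤ S⊆isthm B─A⊆isthm)
          (<-≤-trans (m<m+n rA∖BC (x∈p⇒0<∣p∣ x∈S)) (isthmuses⇒rA∖BC+∣S∣≤rA∖B S⊆isthm))
  sufficiency (inj₂ (inj₂ (inj₁ (S⊆loops , B─C⊆loops)))) = loops⇒L≅R S⊆loops B─C⊆loops
  sufficiency (inj₂ (inj₂ (inj₂ (_ , (_ , B─C⊆loops) , _)))) with nonempty? S | rA∖B ≤? rA∖BC
  ... | no S-empty     | _              = S≡∅⇒L≅R (Empty-unique S-empty)
  ... | yes S-nonempty | yes rA∖B≤rA∖BC =
          uncurry loops⇒L≅R (collapsed⇒loops rA∖B≤rA∖BC S-nonempty)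
  ... | yes _          | no rA∖B≰rA∖BC  =
          Tight.tight⇒L≅R (loops⇒u≤ B─C⊆loops (≰⇒> rA∖B≰rA∖BC)) (≰⇒> rA∖B≰rA∖BC)

theorem6p8 : ∀ {n} (M N P : RankedSet n) →
    IsMatroid M → IsMatroid N → IsMatroid P →
    Matched M N → Matched (M ⋈ N) P → Matched N P → Matched M (N ⋈ P) →
    (((M ⋈ N) ⋈ P) ≅ (M ⋈ (N ⋈ P))
     ⇔ (Empty ((ground M ∩ ground P) ─ ground N)
        ⊎ (((ground M ∩ ground P) ─ ground N) ⊆ₚ isthm M
           × (ground N ─ ground M) ⊆ₚ isthm N)
        ⊎ (((ground M ∩ ground P) ─ ground N) ⊆ₚ loops P
           × (ground N ─ ground P) ⊆ₚ loops N)
        ⊎ ((ground N ⊆ (ground M ∪ ground P))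
           × ((ground N ─ ground M) ⊆ₚ isthm N × (ground N ─ ground P) ⊆ₚ loops N)
           × ModularPair P ((ground M ∩ ground P) ─ ground N)
                           (ground M ∩ (ground N ∩ ground P)))))
theorem6p8 M N P isM isN isP M~N MN~P N~P M~NP = mk⇔ necessity sufficiency
  where open SpliceAssociativity M N P isM isN isP M~N MN~P N~P M~NP
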